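{- For integers $m\ge 2$, $n\ge 1$ and $0\le d\le\lfloor\frac{n-1}{2}\rfloor$, writing $\mathfrak{p}_{m,n}(d)=\#\mathrm{APS}_d(m,n)$, \[ \mathfrak{p}_{m,n}(d)=\sum_{i=0}^{d}\binom{n}{i}\,\mathfrak{p}_{m-1,n-i}(d-i), \] where moreover $\mathfrak{p}_{1,n}(d)=\binom{n-1}{d}$ and $\mathfrak{p}_{m,n}(0)=1$.
   Context: Let $m,n$ be positive integers, $[n]=\{1,\dots,n\}$ and $\xi=e^{2\pi i/m}$. For $0\le a\le m-1$ and $x\in[n]$ write $\xi^a(x)$ for the element $\xi^a\cdot x$, let $\xi^a[n]=\{\xi^a(1),\dots,\xi^a(n)\}$ and $\mathbb{I}_n^m=\bigcup_{a=0}^{m-1}\xi^a[n]$. Totally order $\mathbb{I}_n^m$ by $\prec$, where $\xi^a(x)\prec\xi^b(y)$ iff $a>b$, or $a=b$ and $x>y$. The generalized symmetric group $\mathbb{Z}_m\wr S_n$ is the group of bijections $w$ of $\mathbb{I}_n^m$ with $w(\xi^i x)=\xi^i w(x)$ for all $x\in[n]$ and all $i$; $w$ is determined by $w(1),\dots,w(n)$ and written $w(n)\cdots w(1)$. The pinnacle set is $\operatorname{Pin}(w)=\{w(i): 2\le i\le n-1,\ w(i+1)\prec w(i)\succ w(i-1)\}$. $P\subseteq\mathbb{I}_n^m$ is an admissible pinnacle set if $P=\operatorname{Pin}(w)$ for some $w\in\mathbb{Z}_m\wr S_n$. $\mathrm{APS}_d(m,n)$ is the collection of admissible pinnacle sets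 for $\mathbb{Z}_m\wr S_n$ of cardinality at most $d$, and $\mathfrak{p}_{m,n}(d):=\#\mathrm{APS}_d(m,n)$ for $0\le d\le\lfloor\frac{n-1}{2}\rfloor$. -}

module Defs where

open import Data.Bool using (Bool; true; false; _∧_; _∨_; if_then_else_)
open import Data.Nat using (ℕ; zero; suc; _+_; _<ᵇ_; _≡ᵇ_; _≤ᵇ_)
open import Data.Fin using (Fin; toℕ)
open import Data.Fin.Properties using () renaming (_≟_ to _≟F_)
open import Data.Fin.Subset using (Subset; ∣_∣)
open import Data.Product using (_×_; _,_; proj₁; proj₂)
open import Data.List using (List; []; _∷_; map; concatMap; filter; length; allFin; deduplicate; sum; cartesianProductWith)
open import Data.Bool.ListAction using (any)
open import Data.Vec using (Vec; []; _∷_; toList; tabulate)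
import Data.Vec.Properties as VecP
open import Data.Bool.Properties using () renaming (_≟_ to _≟B_)
import Data.List.Relation.Unary.Unique.DecPropositional as UDP
open import Relation.Nullary.Decidable using (⌊_⌋; Dec)
open import Relation.Binary.PropositionalEquality using (_≡_)
open import Data.Product.Properties using () renaming (≡-dec to ×-≡-dec)
import Data.Vec
open import Data.Nat using (_≤?_)

-- The set 𝕀ₙᵐ: the element ξ^a(x+1) is encoded as the pair (a , x) : Fin m × Fin n.
Elt : ℕ → ℕ → Set
Elt m n = Fin m × Fin n

_≺_ : ∀ {m n} → Elt m n → Elt m n → Bool
(a , x) ≺ (b , y) = (toℕ b <ᵇ toℕ a) ∨ ((toℕ a ≡ᵇ toℕ b) ∧ (toℕ y <ᵇ toℕ x))

allElts : ∀ m n → List (Elt m n)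
allElts m n = cartesianProductWith _,_ (allFin m) (allFin n)

allVecs : ∀ {A : Set} → List A → (k : ℕ) → List (Vec A k)
allVecs xs zero = [] ∷ []
allVecs xs (suc k) = concatMap (λ x → map (x ∷_) (allVecs xs k)) xs

-- An element w of ℤ_m ≀ S_n is determined by (w(1), …, w(n)); these are exactly
-- the vectors of elements of 𝕀ₙᵐ whose underlying [n]-parts are pairwise distinct.
-- Entry number i (0-based) of the vector is w(i+1).
SignedPerms : ∀ m n → List (Vec (Elt m n) n)
SignedPerms m n = filter (λ v → UDP.unique? (_≟F_ {n}) (map proj₂ (toList v))) (allVecs (allElts m n) n)

pinList : ∀ {m n} → List (Elt m n) → List (Elt m n)
pinList (x ∷ y ∷ z ∷ rest) =
  (if (x ≺ y) ∧ (z ≺ y) then y ∷ pinList (y ∷ z ∷ rest) else pinList (y ∷ z ∷ rest))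
pinList _ = []

-- A subset of 𝕀ₙᵐ, as its characteristic vector (row a = the colour-a part).
SubsetI : ℕ → ℕ → Set
SubsetI m n = Vec (Subset n) m

_≟E_ : ∀ {m n} (e f : Elt m n) → Dec (e ≡ f)
_≟E_ = ×-≡-dec _≟F_ _≟F_

toSubsetI : ∀ {m n} → List (Elt m n) → SubsetI m n
toSubsetI xs = tabulate λ a → tabulate λ x → any (λ e → ⌊ (a , x) ≟E e ⌋) xs

Pin : ∀ {m n} → Vec (Elt m n) n → SubsetI m n
Pin w = toSubsetI (pinList (toList w))

card : ∀ {m n} → SubsetI m n → ℕ
card S = Data.Vec.foldr _ (λ row acc → ∣ row ∣ + acc) 0 S

APS : (d m n : ℕ) → List (SubsetI m n)
APS d m n = deduplicate (VecP.≡-dec (VecP.≡-dec _≟B_))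
              (filter (λ P → card P ≤? d) (map Pin (SignedPerms m n)))

𝔭 : ℕ → ℕ → ℕ → ℕ
𝔭 m n d = length (APS d m n)

{-# OPTIONS --safe #-}
module Submission where

-- Pinnacles have pairwise distinct absolute values, so a candidate pinnacle set is a code: for
-- every value x it records the colour of the pinnacle of absolute value x, if there is one.
-- Such a code is a pinnacle set iff it has at most (n - 1) / 2 pinnacles and satisfies a ballot
-- condition on the pinnacles of the bottom colour m - 1.  Necessity: in any word each pinnacle
-- weakly below an element t is followed by a non-pinnacle below t, and the leftmost one is also
-- preceded by one.  Sufficiency: colour every non-pinnacle m - 1, sort these valleys upwards and
-- interleave them with the pinnacles.
-- Counting the ballot codes: pinnacles of the top colour 0 lie above everything and never matter
-- to the ballot condition, so erasing the i of them leaves a ballot code on n - i values with m - 1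
-- colours, after choosing their positions in n C i ways.  With a single colour the counts obey
-- Pascal's rule (at the boundary 2d + 1 = n - 1 through the symmetry of the middle binomials),
-- giving (n - 1) C d, and for d = 0 only the empty code is left.  The size condition is implied
-- by d ≤ (n - 1) / 2.

open import Defs
open import Data.Nat using (ℕ; suc; _+_; _*_; _∸_; _≤_)
open import Data.Nat.DivMod using (_/_)
open import Data.Nat.Combinatorics using (_C_)
open import Data.List using (map; upTo)
open import Data.Nat.ListAction using (sum)
open import Data.Product using (_×_)
open import Relation.Binary.PropositionalEquality using (_≡_)

open import Data.Bool using (Bool; true; false; _∧_; _∨_; not; if_then_else_; T)
open import Data.Bool.ListAction using (any)
open import Data.Bool.Properties using (T?; T-≡; not-injective; ∧-zeroʳ; ∧-identityʳ; ∨-identityʳ)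
open import Data.Empty using (⊥; ⊥-elim)
open import Data.Fin using (Fin; zero; suc; toℕ; fromℕ; fromℕ<)
open import Data.Fin.Properties using (toℕ≤pred[n]; toℕ<n; toℕ-injective; toℕ-fromℕ; toℕ-fromℕ<) renaming (_≟_ to _≟ᶠ_)
open import Data.Fin.Subset using (Subset; ∣_∣)
open import Data.List using (List; []; _∷_; [_]; _++_; length; tabulate; allFin; cartesianProductWith; applyUpTo; filterᵇ)
import Data.List.Properties as List
open import Data.List.Membership.Propositional using (_∈_; _∉_)
import Data.List.Membership.Propositional.Properties as ∈
open import Data.List.Relation.Unary.All using (All; []; _∷_)
import Data.List.Relation.Unary.All as All
import Data.List.Relation.Unary.All.Properties as All
open import Data.List.Relation.Unary.All.Properties using (All¬⇒¬Any)
import Data.List.Relation.Unary.AllPairs as AllPairs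
open import Data.List.Relation.Unary.Any using (here; there)
import Data.List.Relation.Unary.Any as Any
open import Data.List.Relation.Unary.Unique.Propositional using (Unique; []; _∷_)
import Data.List.Relation.Unary.Unique.Propositional.Properties as Unique
import Data.List.Relation.Unary.Unique.DecPropositional as Unique?
import Data.List.Relation.Unary.Unique.DecPropositional.Properties
open import Data.List.Relation.Binary.Permutation.Propositional
  using (_↭_; ↭-refl; ↭-reflexive; ↭-prep; ↭-sym; ↭-trans; ↭⇒↭ₛ; module PermutationReasoning)
import Data.List.Relation.Binary.Permutation.Propositional.Properties as ↭
import Data.List.Relation.Binary.Permutation.Setoid.Properties
open import Data.Maybe using (Maybe; just; nothing; is-just; is-nothing)
open import Data.Nat using (zero; _<_; _≤ᵇ_; _<ᵇ_; _≡ᵇ_; z≤n; s≤s; z<s; _≤?_)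
open import Data.Nat.Combinatorics using (nCk+nC[k+1]≡[n+1]C[k+1]; nCk≡nC[n∸k]; k>n⇒nCk≡0)
open import Data.Nat.DivMod using (m/n*n≤m)
open import Data.Nat.Properties
open import Data.Nat.Solver using (module +-*-Solver)
open import Data.Product using (_,_; proj₁; proj₂; ∃)
open import Data.Sum using (_⊎_; inj₁; inj₂)
open import Data.Unit using (⊤; tt)
open import Data.Vec using (Vec; []; _∷_)
import Data.Vec as Vec
import Data.Vec.Properties as Vec
open import Function using (id; _∘_; Equivalence)
open import Relation.Binary.Definitions using (tri<; tri≈; tri>)
open import Relation.Binary.PropositionalEquality using (setoid; refl; sym; trans; cong; cong₂; subst; subst₂; module ≡-Reasoning)
open import Relation.Nullary using (¬_; Dec; yes; no; does)
open import Relation.Nullary.Decidable using (⌊_⌋; dec-true; dec-false)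

open import Algebra.Properties.Semiring.Sum +-*-semiring
  using (sum-syntax; sum-cong-≗; ∑-distrib-+; ∑-comm; *-distribˡ-sum; sum-replicate-zero)
open +-*-Solver using (solve; _:=_; _:+_; _:*_; con)

private variable
  A B : Set

≡true⇒T : ∀ {b} → b ≡ true → T b
≡true⇒T = Equivalence.from T-≡

T⇒≡true : ∀ {b} → T b → b ≡ true
T⇒≡true = Equivalence.to T-≡

∧≡true⇒ : ∀ {a b} → (a ∧ b) ≡ true → a ≡ true × b ≡ true
∧≡true⇒ {true} {true} _ = refl , refl

∨≡true⇒ : ∀ {a b} → (a ∨ b) ≡ true → a ≡ true ⊎ b ≡ true
∨≡true⇒ {true} _ = inj₁ refl
∨≡true⇒ {false} e = inj₂ e

≡false⇒≢true : ∀ {b} → b ≡ false → ¬ (b ≡ true)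
≡false⇒≢true refl ()

≤⇒≤ᵇ≡true : ∀ {m n} → m ≤ n → (m ≤ᵇ n) ≡ true
≤⇒≤ᵇ≡true = T⇒≡true ∘ ≤⇒≤ᵇ

≤ᵇ≡true⇒≤ : ∀ {m n} → (m ≤ᵇ n) ≡ true → m ≤ n
≤ᵇ≡true⇒≤ {m} {n} = ≤ᵇ⇒≤ m n ∘ ≡true⇒T

<⇒<ᵇ≡true : ∀ {m n} → m < n → (m <ᵇ n) ≡ true
<⇒<ᵇ≡true = T⇒≡true ∘ <⇒<ᵇ

<ᵇ≡true⇒< : ∀ {m n} → (m <ᵇ n) ≡ true → m < n
<ᵇ≡true⇒< {m} {n} = <ᵇ⇒< m n ∘ ≡true⇒T

≡⇒≡ᵇ≡true : ∀ {m n} → m ≡ n → (m ≡ᵇ n) ≡ true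
≡⇒≡ᵇ≡true {m} {n} = T⇒≡true ∘ ≡⇒≡ᵇ m n

≡ᵇ≡true⇒≡ : ∀ {m n} → (m ≡ᵇ n) ≡ true → m ≡ n
≡ᵇ≡true⇒≡ {m} {n} = ≡ᵇ⇒≡ m n ∘ ≡true⇒T

≰⇒≤ᵇ≡false : ∀ {m n} → ¬ (m ≤ n) → (m ≤ᵇ n) ≡ false
≰⇒≤ᵇ≡false {m} {n} m≰n with m ≤ᵇ n in eq
... | true = ⊥-elim (m≰n (≤ᵇ≡true⇒≤ eq))
... | false = refl

≮⇒<ᵇ≡false : ∀ {m n} → ¬ (m < n) → (m <ᵇ n) ≡ false
≮⇒<ᵇ≡false {m} {n} m≮n with m <ᵇ n in eq
... | true = ⊥-elim (m≮n (<ᵇ≡true⇒< eq))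
... | false = refl

≢⇒≡ᵇ≡false : ∀ {m n} → ¬ (m ≡ n) → (m ≡ᵇ n) ≡ false
≢⇒≡ᵇ≡false {m} {n} m≢n with m ≡ᵇ n in eq
... | true = ⊥-elim (m≢n (≡ᵇ≡true⇒≡ eq))
... | false = refl

<ᵇ-suc : ∀ m n → (m <ᵇ suc n) ≡ (m ≤ᵇ n)
<ᵇ-suc zero n = refl
<ᵇ-suc (suc m) n = refl

not-<ᵇ : ∀ m n → not (n <ᵇ m) ≡ (m ≤ᵇ n)
not-<ᵇ zero n = refl
not-<ᵇ (suc m) zero = refl
not-<ᵇ (suc m) (suc n) = trans (not-<ᵇ m n) (sym (<ᵇ-suc m n))

Unique⇒length≤ : ∀ (xs ys : List A) → Unique xs → (∀ {z} → z ∈ xs → z ∈ ys) → length xs ≤ length ys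
Unique⇒length≤ [] ys _ _ = z≤n
Unique⇒length≤ (x ∷ xs) ys (x∉ ∷ uniq) xs⊆ys with ∈.∈-∃++ (xs⊆ys (here refl))
... | ys₁ , ys₂ , refl = begin
  suc (length xs)            ≤⟨ s≤s (Unique⇒length≤ xs (ys₁ ++ ys₂) uniq xs⊆ys₁++ys₂) ⟩
  suc (length (ys₁ ++ ys₂))  ≡⟨ cong suc (List.length-++ ys₁) ⟩
  suc (length ys₁ + length ys₂) ≡⟨ +-suc (length ys₁) (length ys₂) ⟨
  length ys₁ + length (x ∷ ys₂) ≡⟨ List.length-++ ys₁ ⟨
  length (ys₁ ++ x ∷ ys₂)    ∎
  where
  open ≤-Reasoning
  xs⊆ys₁++ys₂ : ∀ {z} → z ∈ xs → z ∈ ys₁ ++ ys₂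
  xs⊆ys₁++ys₂ z∈ with ∈.∈-++⁻ ys₁ (xs⊆ys (there z∈))
  ... | inj₁ z∈ys₁ = ∈.∈-++⁺ˡ z∈ys₁
  ... | inj₂ (here refl) = ⊥-elim (All¬⇒¬Any x∉ z∈)
  ... | inj₂ (there z∈ys₂) = ∈.∈-++⁺ʳ ys₁ z∈ys₂

Unique-map-injective-on : ∀ (f : A → B) xs → (∀ {x y} → x ∈ xs → y ∈ xs → f x ≡ f y → x ≡ y) → Unique xs → Unique (map f xs)
Unique-map-injective-on f [] _ _ = []
Unique-map-injective-on f (x ∷ xs) inj (x∉ ∷ uniq) =
  All.map⁺ (All.tabulate (λ y∈ fx≡fy → All.lookup x∉ y∈ (inj (here refl) (there y∈) fx≡fy)))
  ∷ Unique-map-injective-on f xs (λ x∈ y∈ → inj (there x∈) (there y∈)) uniq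

Unique-++⁻ʳ : ∀ (xs : List A) {ys} → Unique (xs ++ ys) → Unique ys
Unique-++⁻ʳ [] uniq = uniq
Unique-++⁻ʳ (x ∷ xs) (_ ∷ uniq) = Unique-++⁻ʳ xs uniq

Unique-resp-↭ : ∀ {xs ys : List A} → xs ↭ ys → Unique xs → Unique ys
Unique-resp-↭ {A = A} xs↭ys = ↭ₛ.Unique-resp-↭ (↭⇒↭ₛ xs↭ys)
  where module ↭ₛ = Data.List.Relation.Binary.Permutation.Setoid.Properties (setoid A)

𝟙 : Bool → ℕ
𝟙 b = if b then 1 else 0

count : (A → Bool) → List A → ℕ
count p [] = 0
count p (x ∷ xs) = 𝟙 (p x) + count p xs

count-cong-∈ : ∀ {p q : A → Bool} xs → (∀ {x} → x ∈ xs → p x ≡ q x) → count p xs ≡ count q xs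
count-cong-∈ [] _ = refl
count-cong-∈ (x ∷ xs) p≡q = cong₂ _+_ (cong 𝟙 (p≡q (here refl))) (count-cong-∈ xs (p≡q ∘ there))

count-cong : ∀ {p q : A → Bool} xs → (∀ x → p x ≡ q x) → count p xs ≡ count q xs
count-cong xs p≡q = count-cong-∈ xs (λ {x} _ → p≡q x)

count-++ : ∀ (p : A → Bool) xs ys → count p (xs ++ ys) ≡ count p xs + count p ys
count-++ p [] ys = refl
count-++ p (x ∷ xs) ys = trans (cong (𝟙 (p x) +_) (count-++ p xs ys)) (sym (+-assoc (𝟙 (p x)) _ _))

count-map : ∀ (p : B → Bool) (f : A → B) xs → count p (map f xs) ≡ count (p ∘ f) xs
count-map p f [] = refl
count-map p f (x ∷ xs) = cong (𝟙 (p (f x)) +_) (count-map p f xs)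

count-false : ∀ (xs : List A) → count (λ _ → false) xs ≡ 0
count-false [] = refl
count-false (x ∷ xs) = count-false xs

count-true : ∀ (xs : List A) → count (λ _ → true) xs ≡ length xs
count-true [] = refl
count-true (x ∷ xs) = cong suc (count-true xs)

count-cartesian-tabulate : ∀ {n} (p : List A → Bool) (f : Fin n → A) ys →
  count p (cartesianProductWith _∷_ (tabulate f) ys) ≡ ∑[ i < n ] count (p ∘ (f i ∷_)) ys
count-cartesian-tabulate {n = zero} p f ys = refl
count-cartesian-tabulate {n = suc n} p f ys = begin
  count p (map (f zero ∷_) ys ++ cartesianProductWith _∷_ (tabulate (f ∘ suc)) ys)
    ≡⟨ count-++ p (map (f zero ∷_) ys) _ ⟩
  count p (map (f zero ∷_) ys) + count p (cartesianProductWith _∷_ (tabulate (f ∘ suc)) ys)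
    ≡⟨ cong₂ _+_ (count-map p (f zero ∷_) ys) (count-cartesian-tabulate p (f ∘ suc) ys) ⟩
  count (p ∘ (f zero ∷_)) ys + ∑[ i < n ] count (p ∘ (f (suc i) ∷_)) ys ∎
  where open ≡-Reasoning

∑-𝟙-≡ᵇ : ∀ {n} (v : ℕ) (b : Bool) → (b ≡ true → v < n) → ∑[ i < n ] 𝟙 ((v ≡ᵇ toℕ i) ∧ b) ≡ 𝟙 b
∑-𝟙-≡ᵇ {zero} v false _ = refl
∑-𝟙-≡ᵇ {zero} v true v<0 with () ← v<0 refl
∑-𝟙-≡ᵇ {suc n} zero b _ = trans (cong (𝟙 b +_) (sum-replicate-zero n)) (+-identityʳ (𝟙 b))
∑-𝟙-≡ᵇ {suc n} (suc v) b v<n = ∑-𝟙-≡ᵇ v b (≤-pred ∘ v<n)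

∑-𝟙-≟ : ∀ {n} (x : Fin n) (g : Fin n → Bool) → ∑[ y < n ] 𝟙 (does (x ≟ᶠ y) ∧ g y) ≡ 𝟙 (g x)
∑-𝟙-≟ {suc n} zero g = trans (cong (𝟙 (g zero) +_) (sum-replicate-zero n)) (+-identityʳ (𝟙 (g zero)))
∑-𝟙-≟ {suc n} (suc x) g = ∑-𝟙-≟ x (g ∘ suc)

∑-mono-≤ : ∀ {n} {f g : Fin n → ℕ} → (∀ i → f i ≤ g i) → ∑[ i < n ] f i ≤ ∑[ i < n ] g i
∑-mono-≤ {zero} _ = z≤n
∑-mono-≤ {suc n} f≤g = +-mono-≤ (f≤g zero) (∑-mono-≤ (f≤g ∘ suc))

𝟙-mono : ∀ {a b} → (a ≡ true → b ≡ true) → 𝟙 a ≤ 𝟙 b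
𝟙-mono {false} _ = z≤n
𝟙-mono {true} a⇒b rewrite a⇒b refl = ≤-refl

count-tabulate : ∀ {n} (p : A → Bool) (f : Fin n → A) → count p (tabulate f) ≡ ∑[ i < n ] 𝟙 (p (f i))
count-tabulate {n = zero} p f = refl
count-tabulate {n = suc n} p f = cong (𝟙 (p (f zero)) +_) (count-tabulate p (f ∘ suc))

count-partition : ∀ (p : A → Bool) (f : A → ℕ) d xs → (∀ x → p x ≡ true → f x ≤ d) →
  count p xs ≡ ∑[ i < suc d ] count (λ x → (f x ≡ᵇ toℕ i) ∧ p x) xs
count-partition p f d [] _ = sym (sum-replicate-zero (suc d))
count-partition p f d (x ∷ xs) f≤d = begin
  𝟙 (p x) + count p xs
    ≡⟨ cong₂ _+_ (sym (∑-𝟙-≡ᵇ (f x) (p x) (s≤s ∘ f≤d x))) (count-partition p f d xs f≤d) ⟩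
  ∑[ i < suc d ] 𝟙 ((f x ≡ᵇ toℕ i) ∧ p x) + ∑[ i < suc d ] count (λ x → (f x ≡ᵇ toℕ i) ∧ p x) xs
    ≡⟨ sym (∑-distrib-+ {suc d} (λ i → 𝟙 ((f x ≡ᵇ toℕ i) ∧ p x)) (λ i → count (λ x → (f x ≡ᵇ toℕ i) ∧ p x) xs)) ⟩
  ∑[ i < suc d ] count (λ x → (f x ≡ᵇ toℕ i) ∧ p x) (x ∷ xs) ∎
  where open ≡-Reasoning

length-filterᵇ : ∀ (p : A → Bool) xs → length (filterᵇ p xs) ≡ count p xs
length-filterᵇ p [] = refl
length-filterᵇ p (x ∷ xs) with p x
... | true = cong suc (length-filterᵇ p xs)
... | false = length-filterᵇ p xs

sum-applyUpTo : ∀ (f : ℕ → ℕ) N → sum (applyUpTo f N) ≡ ∑[ i < N ] f (toℕ i)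
sum-applyUpTo f zero = refl
sum-applyUpTo f (suc N) = cong (f 0 +_) (sum-applyUpTo (f ∘ suc) N)

sum-map-upTo : ∀ (f : ℕ → ℕ) N → sum (map f (upTo N)) ≡ ∑[ i < N ] f (toℕ i)
sum-map-upTo f N = trans (cong sum (List.map-applyUpTo id f N)) (sum-applyUpTo f N)

𝟙-≤ᵇ-split : ∀ {n} (x y : Fin n) b →
  𝟙 ((toℕ x ≤ᵇ toℕ y) ∧ b) ≡ 𝟙 (does (x ≟ᶠ y) ∧ b) + 𝟙 ((toℕ x <ᵇ toℕ y) ∧ b)
𝟙-≤ᵇ-split x y b with <-cmp (toℕ x) (toℕ y)
... | tri< x<y x≢y _ rewrite ≤⇒≤ᵇ≡true (<⇒≤ x<y) | <⇒<ᵇ≡true x<y | dec-false (x ≟ᶠ y) (x≢y ∘ cong toℕ) = refl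
... | tri> x≮y x≢y y<x rewrite ≰⇒≤ᵇ≡false (<⇒≱ y<x) | ≮⇒<ᵇ≡false x≮y | dec-false (x ≟ᶠ y) (x≢y ∘ cong toℕ) = refl
... | tri≈ _ x≡y _ with refl ← toℕ-injective x≡y rewrite ≤⇒≤ᵇ≡true (≤-refl {toℕ x}) | ≮⇒<ᵇ≡false (<-irrefl (refl {x = toℕ x})) | dec-true (x ≟ᶠ x) refl =
  sym (+-identityʳ (𝟙 b))

-- Codes and the ballot condition

-- Entry x of a code is the colour of the pinnacle of absolute value x + 1, if there is one.
Code : ℕ → Set
Code m = List (Maybe (Fin m))

statuses : ∀ m → List (Maybe (Fin m))
statuses m = nothing ∷ tabulate just

codes : ∀ m → ℕ → List (Code m)
codes m zero = [ [] ]
codes m (suc n) = cartesianProductWith _∷_ (statuses m) (codes m n)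

count-codes-suc : ∀ m n (p : Code m → Bool) →
  count p (codes m (suc n)) ≡ count (p ∘ (nothing ∷_)) (codes m n) + ∑[ a < m ] count (p ∘ (just a ∷_)) (codes m n)
count-codes-suc m n p = begin
  count p (map (nothing ∷_) (codes m n) ++ cartesianProductWith _∷_ (tabulate just) (codes m n))
    ≡⟨ count-++ p (map (nothing ∷_) (codes m n)) _ ⟩
  count p (map (nothing ∷_) (codes m n)) + count p (cartesianProductWith _∷_ (tabulate just) (codes m n))
    ≡⟨ cong₂ _+_ (count-map p (nothing ∷_) (codes m n)) (count-cartesian-tabulate p just (codes m n)) ⟩
  count (p ∘ (nothing ∷_)) (codes m n) + ∑[ a < m ] count (p ∘ (just a ∷_)) (codes m n) ∎
  where open ≡-Reasoning

∈-codes⇒length : ∀ {m} n {s : Code m} → s ∈ codes m n → length s ≡ n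
∈-codes⇒length zero (here refl) = refl
∈-codes⇒length {m} (suc n) s∈ with ∈.∈-cartesianProductWith⁻ _∷_ (statuses m) (codes m n) s∈
... | _ , r , _ , r∈ , refl = cong suc (∈-codes⇒length n r∈)

count-cong-codes : ∀ m n {p q : Code m → Bool} → (∀ s → length s ≡ n → p s ≡ q s) →
  count p (codes m n) ≡ count q (codes m n)
count-cong-codes m n p≡q = count-cong-∈ (codes m n) (λ {s} s∈ → p≡q s (∈-codes⇒length n s∈))

∈-statuses : ∀ {m} (h : Maybe (Fin m)) → h ∈ statuses m
∈-statuses nothing = here refl
∈-statuses (just c) = there (∈.∈-tabulate⁺ c)

∈-codes : ∀ {m} n (s : Code m) → length s ≡ n → s ∈ codes m n
∈-codes zero [] _ = here refl
∈-codes (suc n) (h ∷ s) len = ∈.∈-cartesianProductWith⁺ _∷_ (∈-statuses h) (∈-codes n s (suc-injective len))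

Unique-codes : ∀ m n → Unique (codes m n)
Unique-codes m zero = [] ∷ []
Unique-codes m (suc n) = Unique.cartesianProductWith⁺ _∷_ List.∷-injective
  (All.tabulate⁺ {f = just} (λ _ ()) ∷ Unique.tabulate⁺ {n = m} {f = just} (λ { refl → refl })) (Unique-codes m n)

hasColour : ∀ {m} → Fin m → Maybe (Fin m) → Bool
hasColour a nothing = false
hasColour a (just b) = does (a ≟ᶠ b)

size holes : ∀ {m} → Code m → ℕ
size = count is-just
holes = count is-nothing

length≡holes+size : ∀ {m} (s : Code m) → length s ≡ holes s + size s
length≡holes+size [] = refl
length≡holes+size (nothing ∷ s) = cong suc (length≡holes+size s)
length≡holes+size (just _ ∷ s) = trans (cong suc (length≡holes+size s)) (sym (+-suc _ _))

isLowest : ∀ {k} → Maybe (Fin (suc k)) → Bool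
isLowest nothing = false
isLowest {k} (just c) = toℕ c ≡ᵇ k

-- Colour k is the bottom class of ≺ and within a class larger values are smaller, so the later
-- entries of a code hold the candidates below a pinnacle of colour k.  Non-pinnacles may as well
-- be coloured k; there must be two more of them than later pinnacles of colour k.
ballot : ∀ {k} → Code (suc k) → Bool
ballot [] = true
ballot (nothing ∷ r) = ballot r
ballot (just c ∷ r) = ballot r ∧ (not (isLowest (just c)) ∨ (count isLowest r + 2 ≤ᵇ holes r))

admissible : ∀ {k} → Code (suc k) → Bool
admissible s = ballot s ∧ (2 * size s ≤ᵇ length s ∸ 1)

ballotCount : ℕ → ℕ → ℕ → ℕ
ballotCount k n d = count (λ s → ballot s ∧ (size s ≤ᵇ d)) (codes (suc k) n)

admissible≡ballot : ∀ {k} d (s : Code (suc k)) → 2 * d ≤ length s ∸ 1 →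
  (admissible s ∧ (size s ≤ᵇ d)) ≡ (ballot s ∧ (size s ≤ᵇ d))
admissible≡ballot d s 2d≤ with size s ≤ᵇ d in size≤d
... | false = trans (∧-zeroʳ _) (sym (∧-zeroʳ _))
... | true = cong (_∧ true) (trans (cong (ballot s ∧_) (≤⇒≤ᵇ≡true 2size≤)) (∧-identityʳ (ballot s)))
  where
  2size≤ : 2 * size s ≤ length s ∸ 1
  2size≤ = ≤-trans (*-monoʳ-≤ 2 (≤ᵇ≡true⇒≤ {size s} size≤d)) 2d≤

count-admissible≡ballotCount : ∀ k n d → 2 * d ≤ n ∸ 1 →
  count (λ s → admissible s ∧ (size s ≤ᵇ d)) (codes (suc k) n) ≡ ballotCount k n d
count-admissible≡ballotCount k n d 2d≤ =
  count-cong-codes (suc k) n (λ s len → admissible≡ballot d s (subst (λ l → 2 * d ≤ l ∸ 1) (sym len) 2d≤))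

ballot-size0 : ∀ {k} (s : Code (suc k)) → size s ≡ 0 → ballot s ≡ true
ballot-size0 [] _ = refl
ballot-size0 (nothing ∷ s) = ballot-size0 s

ballotCount-zero : ∀ k n → ballotCount k n 0 ≡ 1
ballotCount-zero k n = trans (count-cong (codes (suc k) n) ballot≤0≡size≡0) (empty-only n)
  where
  ballot≤0≡size≡0 : ∀ s → (ballot s ∧ (size s ≤ᵇ 0)) ≡ (size s ≡ᵇ 0)
  ballot≤0≡size≡0 s with size s in eq
  ... | zero rewrite ballot-size0 s eq = refl
  ... | suc _ = ∧-zeroʳ _
  empty-only : ∀ n → count (λ s → size s ≡ᵇ 0) (codes (suc k) n) ≡ 1
  empty-only zero = refl
  empty-only (suc n) = begin
    count (λ s → size s ≡ᵇ 0) (codes (suc k) (suc n))  ≡⟨ count-codes-suc (suc k) n _ ⟩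
    count (λ s → size s ≡ᵇ 0) (codes (suc k) n) + ∑[ a < suc k ] count (λ _ → false) (codes (suc k) n)
      ≡⟨ cong₂ _+_ (empty-only n) (sum-cong-≗ {suc k} (λ _ → count-false (codes (suc k) n))) ⟩
    1 + ∑[ a < suc k ] 0                               ≡⟨ cong (1 +_) (sum-replicate-zero (suc k)) ⟩
    1                                                  ∎
    where open ≡-Reasoning

count-isLowest-one-colour : (s : Code 1) → count isLowest s ≡ size s
count-isLowest-one-colour [] = refl
count-isLowest-one-colour (nothing ∷ s) = count-isLowest-one-colour s
count-isLowest-one-colour (just zero ∷ s) = cong suc (count-isLowest-one-colour s)

ballot-one-colour⇒size : (s : Code 1) → ballot s ≡ true → 2 * size s ≤ length s ∸ 1
ballot-one-colour⇒size [] _ = z≤n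
ballot-one-colour⇒size (nothing ∷ s) b = ≤-trans (ballot-one-colour⇒size s b) (m∸n≤m (length s) 1)
ballot-one-colour⇒size (just zero ∷ s) b = begin
  2 * suc (size s)     ≡⟨ solve 1 (λ x → con 2 :* (con 1 :+ x) := x :+ con 2 :+ x) refl (size s) ⟩
  size s + 2 + size s  ≤⟨ +-monoˡ-≤ (size s) room ⟩
  holes s + size s     ≡⟨ length≡holes+size s ⟨
  length s             ∎
  where
  open ≤-Reasoning
  room : size s + 2 ≤ holes s
  room = subst (λ c → c + 2 ≤ holes s) (count-isLowest-one-colour s) (≤ᵇ≡true⇒≤ (proj₂ (∧≡true⇒ {ballot s} b)))

-- A leading pinnacle meets its own ballot condition automatically once 2 (d + 1) ≤ n.
ballotCount-one-colour-suc : ∀ n d → 2 * suc d ≤ n →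
  ballotCount 0 (suc n) (suc d) ≡ ballotCount 0 n (suc d) + ballotCount 0 n d
ballotCount-one-colour-suc n d 2d+2≤n =
  trans (count-codes-suc 1 n _) (cong (ballotCount 0 n (suc d) +_) (trans (+-identityʳ _) (count-cong-codes 1 n pinnacle-first)))
  where
  pinnacle-first : ∀ s → length s ≡ n →
    ((ballot s ∧ (count isLowest s + 2 ≤ᵇ holes s)) ∧ (size s <ᵇ suc d)) ≡ (ballot s ∧ (size s ≤ᵇ d))
  pinnacle-first s len rewrite <ᵇ-suc (size s) d | count-isLowest-one-colour s with ballot s | size s ≤ᵇ d in size≤d
  ... | false | _ = refl
  ... | true | false = ∧-zeroʳ _
  ... | true | true = cong (_∧ true) (≤⇒≤ᵇ≡true (+-cancelʳ-≤ (size s) _ _ room))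
    where
    open ≤-Reasoning
    room : size s + 2 + size s ≤ holes s + size s
    room = begin
      size s + 2 + size s  ≡⟨ solve 1 (λ x → x :+ con 2 :+ x := con 2 :+ con 2 :* x) refl (size s) ⟩
      2 + 2 * size s       ≤⟨ +-monoʳ-≤ 2 (*-monoʳ-≤ 2 (≤ᵇ≡true⇒≤ {size s} size≤d)) ⟩
      2 + 2 * d            ≡⟨ *-suc 2 d ⟨
      2 * suc d            ≤⟨ 2d+2≤n ⟩
      n                    ≡⟨ trans (sym len) (length≡holes+size s) ⟩
      holes s + size s     ∎

ballotCount-one-colour-saturated : ∀ d → ballotCount 0 (2 + 2 * d) (suc d) ≡ ballotCount 0 (2 + 2 * d) d
ballotCount-one-colour-saturated d = count-cong-codes 1 (2 + 2 * d) saturated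
  where
  saturated : ∀ s → length s ≡ 2 + 2 * d → (ballot s ∧ (size s ≤ᵇ suc d)) ≡ (ballot s ∧ (size s ≤ᵇ d))
  saturated s len with ballot s in b
  ... | false = refl
  ... | true = trans (≤⇒≤ᵇ≡true (m≤n⇒m≤1+n size≤d)) (sym (≤⇒≤ᵇ≡true size≤d))
    where
    size≤d : size s ≤ d
    size≤d = ≤-pred (*-cancelˡ-< 2 (size s) (suc d) (begin-strict
      2 * size s      ≤⟨ ballot-one-colour⇒size s b ⟩
      length s ∸ 1    ≡⟨ cong (_∸ 1) len ⟩
      suc (2 * d)     <⟨ n<1+n _ ⟩
      2 + 2 * d       ≡⟨ *-suc 2 d ⟨
      2 * suc d       ∎))
      where open ≤-Reasoning

middle-binomials : ∀ d → suc (2 * d) C d ≡ suc (2 * d) C suc d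
middle-binomials d = sym (begin
  suc (2 * d) C suc d          ≡⟨ nCk≡nC[n∸k] (s≤s (m≤m+n d (d + 0))) ⟩
  suc (2 * d) C (2 * d ∸ d)    ≡⟨ cong (suc (2 * d) C_) (trans (m+n∸m≡n d (d + 0)) (+-identityʳ d)) ⟩
  suc (2 * d) C d              ∎)
  where open ≡-Reasoning

ballotCount-one-colour : ∀ k d → 2 * d ≤ k → ballotCount 0 (suc k) d ≡ k C d
ballotCount-one-colour k zero _ = ballotCount-zero 0 (suc k)
ballotCount-one-colour (suc k) (suc d) 2d+2≤k+1 = begin
  ballotCount 0 (2 + k) (suc d)                    ≡⟨ ballotCount-one-colour-suc (suc k) d 2d+2≤k+1 ⟩
  ballotCount 0 (suc k) (suc d) + ballotCount 0 (suc k) d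
    ≡⟨ cong₂ _+_ (upper (2 * suc d ≤? k)) lower ⟩
  k C suc d + k C d                                ≡⟨ +-comm (k C suc d) (k C d) ⟩
  k C d + k C suc d                                ≡⟨ nCk+nC[k+1]≡[n+1]C[k+1] k d ⟩
  suc k C suc d                                    ∎
  where
  open ≡-Reasoning
  2d+1≤k : suc (2 * d) ≤ k
  2d+1≤k = ≤-pred (subst (_≤ suc k) (*-suc 2 d) 2d+2≤k+1)
  lower : ballotCount 0 (suc k) d ≡ k C d
  lower = ballotCount-one-colour k d (≤-trans (n≤1+n _) 2d+1≤k)
  saturated : ∀ {k} → k ≡ suc (2 * d) → ballotCount 0 (suc k) d ≡ k C d → ballotCount 0 (suc k) (suc d) ≡ k C suc d
  saturated refl count≡ = begin
    ballotCount 0 (2 + 2 * d) (suc d)  ≡⟨ ballotCount-one-colour-saturated d ⟩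
    ballotCount 0 (2 + 2 * d) d        ≡⟨ count≡ ⟩
    suc (2 * d) C d                    ≡⟨ middle-binomials d ⟩
    suc (2 * d) C suc d                ∎
  upper : Dec (2 * suc d ≤ k) → ballotCount 0 (suc k) (suc d) ≡ k C suc d
  upper (yes 2d+2≤k) = ballotCount-one-colour k (suc d) 2d+2≤k
  upper (no 2d+2≰k) = saturated (≤-antisym (≤-pred (subst (suc k ≤_) (*-suc 2 d) (≰⇒> 2d+2≰k))) 2d+1≤k) lower

isTop : ∀ {k} → Maybe (Fin (suc (suc k))) → Bool
isTop (just zero) = true
isTop _ = false

topCount : ∀ {k} → Code (suc (suc k)) → ℕ
topCount = count isTop

dropTop : ∀ {k} → Code (suc (suc k)) → Code (suc k)
dropTop [] = []
dropTop (nothing ∷ r) = nothing ∷ dropTop r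
dropTop (just zero ∷ r) = dropTop r
dropTop (just (suc c) ∷ r) = just c ∷ dropTop r

holes-dropTop : ∀ {k} (s : Code (suc (suc k))) → holes s ≡ holes (dropTop s)
holes-dropTop [] = refl
holes-dropTop (nothing ∷ r) = cong suc (holes-dropTop r)
holes-dropTop (just zero ∷ r) = holes-dropTop r
holes-dropTop (just (suc c) ∷ r) = holes-dropTop r

count-isLowest-dropTop : ∀ {k} (s : Code (suc (suc k))) → count isLowest s ≡ count isLowest (dropTop s)
count-isLowest-dropTop [] = refl
count-isLowest-dropTop (nothing ∷ r) = count-isLowest-dropTop r
count-isLowest-dropTop (just zero ∷ r) = count-isLowest-dropTop r
count-isLowest-dropTop (just (suc c) ∷ r) = cong (𝟙 (isLowest (just c)) +_) (count-isLowest-dropTop r)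

ballot-dropTop : ∀ {k} (s : Code (suc (suc k))) → ballot s ≡ ballot (dropTop s)
ballot-dropTop [] = refl
ballot-dropTop (nothing ∷ r) = ballot-dropTop r
ballot-dropTop (just zero ∷ r) = trans (∧-identityʳ _) (ballot-dropTop r)
ballot-dropTop (just (suc c) ∷ r) rewrite ballot-dropTop r | count-isLowest-dropTop r | holes-dropTop r = refl

size-dropTop : ∀ {k} (s : Code (suc (suc k))) → size s ≡ topCount s + size (dropTop s)
size-dropTop [] = refl
size-dropTop (nothing ∷ r) = size-dropTop r
size-dropTop (just zero ∷ r) = cong suc (size-dropTop r)
size-dropTop (just (suc c) ∷ r) = trans (cong suc (size-dropTop r)) (sym (+-suc _ _))

count-codes-by-top : ∀ {k} n i (Q : Code (suc k) → Bool) →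
  count (λ s → (topCount s ≡ᵇ i) ∧ Q (dropTop s)) (codes (suc (suc k)) n) ≡ (n C i) * count Q (codes (suc k) (n ∸ i))

count-codes-by-top-suc : ∀ {k} n i (Q : Code (suc k) → Bool) →
  count (λ s → (topCount s ≡ᵇ i) ∧ Q (dropTop s)) (codes (suc (suc k)) (suc n)) ≡
  count (λ s → (suc (topCount s) ≡ᵇ i) ∧ Q (dropTop s)) (codes (suc (suc k)) n) + (n C i) * count Q (codes (suc k) (suc (n ∸ i)))
count-codes-by-top-suc {k} n i Q = begin
  count P (codes (suc (suc k)) (suc n))
    ≡⟨ count-codes-suc (suc (suc k)) n P ⟩
  lead-hole + (lead-top + ∑[ c < suc k ] lead-other c)
    ≡⟨ cong₂ (λ x z → x + (lead-top + z)) lead-hole≡ (sum-cong-≗ {suc k} lead-other≡) ⟩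
  lead-hole′ + (lead-top + ∑[ c < suc k ] lead-other′ c)
    ≡⟨ solve 3 (λ x y z → x :+ (y :+ z) := y :+ (x :+ z)) refl lead-hole′ lead-top _ ⟩
  lead-top + (lead-hole′ + ∑[ c < suc k ] lead-other′ c)
    ≡⟨ cong (λ z → lead-top + (lead-hole′ + z)) (sym (*-distribˡ-sum (n C i) (λ c → count (Q ∘ (just c ∷_)) rest))) ⟩
  lead-top + ((n C i) * count (Q ∘ (nothing ∷_)) rest + (n C i) * ∑[ c < suc k ] count (Q ∘ (just c ∷_)) rest)
    ≡⟨ cong (lead-top +_) (sym (*-distribˡ-+ (n C i) _ _)) ⟩
  lead-top + (n C i) * (count (Q ∘ (nothing ∷_)) rest + ∑[ c < suc k ] count (Q ∘ (just c ∷_)) rest)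
    ≡⟨ cong (λ z → lead-top + (n C i) * z) (sym (count-codes-suc (suc k) (n ∸ i) Q)) ⟩
  lead-top + (n C i) * count Q (codes (suc k) (suc (n ∸ i))) ∎
  where
  open ≡-Reasoning
  P = λ s → (topCount s ≡ᵇ i) ∧ Q (dropTop s)
  rest = codes (suc k) (n ∸ i)
  lead-hole = count (P ∘ (nothing ∷_)) (codes (suc (suc k)) n)
  lead-hole′ = (n C i) * count (Q ∘ (nothing ∷_)) rest
  lead-hole≡ : lead-hole ≡ lead-hole′
  lead-hole≡ = count-codes-by-top n i (Q ∘ (nothing ∷_))
  lead-top = count (P ∘ (just zero ∷_)) (codes (suc (suc k)) n)
  lead-other lead-other′ : Fin (suc k) → ℕ
  lead-other c = count (P ∘ (just (suc c) ∷_)) (codes (suc (suc k)) n)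
  lead-other′ c = (n C i) * count (Q ∘ (just c ∷_)) rest
  lead-other≡ : ∀ c → lead-other c ≡ lead-other′ c
  lead-other≡ c = count-codes-by-top n i (Q ∘ (just c ∷_))

count-codes-by-top zero zero Q = sym (+-identityʳ _)
count-codes-by-top zero (suc i) Q = refl
count-codes-by-top {k} (suc n) zero Q =
  trans (count-codes-by-top-suc n zero Q) (cong (_+ (count Q (codes (suc k) (suc n)) + 0)) (count-false (codes (suc (suc k)) n)))
count-codes-by-top {k} (suc n) (suc i) Q = begin
  count (λ s → (topCount s ≡ᵇ suc i) ∧ Q (dropTop s)) (codes (suc (suc k)) (suc n))
    ≡⟨ count-codes-by-top-suc n (suc i) Q ⟩
  count (λ s → (topCount s ≡ᵇ i) ∧ Q (dropTop s)) (codes (suc (suc k)) n) + (n C suc i) * count Q (codes (suc k) (suc (n ∸ suc i)))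
    ≡⟨ cong₂ _+_ (count-codes-by-top n i Q) (shorter (suc i ≤? n)) ⟩
  (n C i) * count Q rest + (n C suc i) * count Q rest ≡⟨ *-distribʳ-+ (count Q rest) (n C i) (n C suc i) ⟨
  (n C i + n C suc i) * count Q rest              ≡⟨ cong (_* count Q rest) (nCk+nC[k+1]≡[n+1]C[k+1] n i) ⟩
  (suc n C suc i) * count Q rest                    ∎
  where
  open ≡-Reasoning
  rest = codes (suc k) (n ∸ i)
  shorter : Dec (suc i ≤ n) → (n C suc i) * count Q (codes (suc k) (suc (n ∸ suc i))) ≡ (n C suc i) * count Q rest
  shorter (yes i<n) = cong (λ l → (n C suc i) * count Q (codes (suc k) l)) (sym (+-∸-assoc 1 i<n))
  shorter (no i≮n) rewrite k>n⇒nCk≡0 (≰⇒> i≮n) = refl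

+-≤ᵇ-shift : ∀ i k d → i ≤ d → (i + k ≤ᵇ d) ≡ (k ≤ᵇ d ∸ i)
+-≤ᵇ-shift zero k d _ = refl
+-≤ᵇ-shift (suc i) k (suc d) (s≤s i≤d) = trans (<ᵇ-suc (i + k) d) (+-≤ᵇ-shift i k d i≤d)

ballotCount-recursion : ∀ k n d →
  ballotCount (suc k) n d ≡ ∑[ i < suc d ] ((n C toℕ i) * ballotCount k (n ∸ toℕ i) (d ∸ toℕ i))
ballotCount-recursion k n d = begin
  ballotCount (suc k) n d                                   ≡⟨ count-cong (codes (suc (suc k)) n) via-dropTop ⟩
  count split (codes (suc (suc k)) n)                       ≡⟨ count-partition split topCount d (codes (suc (suc k)) n) topCount≤d ⟩
  ∑[ i < suc d ] count (λ s → (topCount s ≡ᵇ toℕ i) ∧ split s) (codes (suc (suc k)) n)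
    ≡⟨ sum-cong-≗ {suc d} (λ i → trans (count-cong (codes (suc (suc k)) n) (shift (toℕ i) (toℕ≤pred[n] i)))
                                       (count-codes-by-top n (toℕ i) (λ r → ballot r ∧ (size r ≤ᵇ d ∸ toℕ i)))) ⟩
  ∑[ i < suc d ] ((n C toℕ i) * ballotCount k (n ∸ toℕ i) (d ∸ toℕ i)) ∎
  where
  open ≡-Reasoning
  split : Code (suc (suc k)) → Bool
  split s = ballot (dropTop s) ∧ (topCount s + size (dropTop s) ≤ᵇ d)
  via-dropTop : ∀ s → (ballot s ∧ (size s ≤ᵇ d)) ≡ split s
  via-dropTop s rewrite ballot-dropTop s | size-dropTop s = refl
  topCount≤d : ∀ s → split s ≡ true → topCount s ≤ d
  topCount≤d s h = ≤-trans (m≤m+n (topCount s) _) (≤ᵇ≡true⇒≤ (proj₂ (∧≡true⇒ {ballot (dropTop s)} h)))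
  shift : ∀ i → i ≤ d → ∀ s → ((topCount s ≡ᵇ i) ∧ split s) ≡ ((topCount s ≡ᵇ i) ∧ (ballot (dropTop s) ∧ (size (dropTop s) ≤ᵇ d ∸ i)))
  shift i i≤d s with topCount s ≡ᵇ i in eq
  ... | false = refl
  ... | true rewrite ≡ᵇ≡true⇒≡ {topCount s} eq = cong (ballot (dropTop s) ∧_) (+-≤ᵇ-shift i (size (dropTop s)) d i≤d)

module _ {m n : ℕ} where

  private
    E = Elt m n

  _⊏_ : E → E → Set
  (a , x) ⊏ (b , y) = toℕ b < toℕ a ⊎ (toℕ a ≡ toℕ b × toℕ y < toℕ x)

  ≺⇒⊏ : ∀ e f → (e ≺ f) ≡ true → e ⊏ f
  ≺⇒⊏ (a , x) (b , y) h with ∨≡true⇒ {toℕ b <ᵇ toℕ a} h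
  ... | inj₁ b<a = inj₁ (<ᵇ≡true⇒< b<a)
  ... | inj₂ same with ∧≡true⇒ {toℕ a ≡ᵇ toℕ b} same
  ...   | a≡b , y<x = inj₂ (≡ᵇ≡true⇒≡ a≡b , <ᵇ≡true⇒< y<x)

  private
    ⊏⇒≺ : ∀ e f → e ⊏ f → (e ≺ f) ≡ true
    ⊏⇒≺ (a , x) (b , y) (inj₁ b<a) rewrite <⇒<ᵇ≡true b<a = refl
    ⊏⇒≺ (a , x) (b , y) (inj₂ (a≡b , y<x))
      rewrite ≮⇒<ᵇ≡false (<-irrefl (sym a≡b)) | ≡⇒≡ᵇ≡true a≡b | <⇒<ᵇ≡true y<x = refl

    ⊏-trans : ∀ e f g → e ⊏ f → f ⊏ g → e ⊏ g
    ⊏-trans _ _ _ (inj₁ p) (inj₁ q) = inj₁ (<-trans q p)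
    ⊏-trans _ _ _ (inj₁ p) (inj₂ (q , _)) = inj₁ (subst (_< _) q p)
    ⊏-trans _ _ _ (inj₂ (p , _)) (inj₁ q) = inj₁ (subst (_ <_) (sym p) q)
    ⊏-trans _ _ _ (inj₂ (p , r)) (inj₂ (q , s)) = inj₂ (trans p q , <-trans s r)

    ⊏-asym : ∀ e f → e ⊏ f → ¬ f ⊏ e
    ⊏-asym _ _ (inj₁ p) (inj₁ q) = <-asym p q
    ⊏-asym _ _ (inj₁ p) (inj₂ (q , _)) = <-irrefl q p
    ⊏-asym _ _ (inj₂ (p , _)) (inj₁ q) = <-irrefl p q
    ⊏-asym _ _ (inj₂ (_ , r)) (inj₂ (_ , s)) = <-asym r s

  ≺-by-colour : ∀ (e f : E) → toℕ (proj₁ f) < toℕ (proj₁ e) → (e ≺ f) ≡ true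
  ≺-by-colour e f b<a = ⊏⇒≺ e f (inj₁ b<a)

  ≺-within-colour : ∀ (e f : E) → toℕ (proj₁ e) ≡ toℕ (proj₁ f) → toℕ (proj₂ f) < toℕ (proj₂ e) → (e ≺ f) ≡ true
  ≺-within-colour e f a≡b y<x = ⊏⇒≺ e f (inj₂ (a≡b , y<x))

  ≺-trans : ∀ e f g → (e ≺ f) ≡ true → (f ≺ g) ≡ true → (e ≺ g) ≡ true
  ≺-trans e f g e≺f f≺g = ⊏⇒≺ e g (⊏-trans e f g (≺⇒⊏ e f e≺f) (≺⇒⊏ f g f≺g))

  ≺-asym : ∀ e f → (e ≺ f) ≡ true → (f ≺ e) ≡ false
  ≺-asym e f e≺f with f ≺ e in f≺e
  ... | true = ⊥-elim (⊏-asym e f (≺⇒⊏ e f e≺f) (≺⇒⊏ f e f≺e))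
  ... | false = refl

  ≺-connex : ∀ e f → (e ≺ f) ≡ false → (f ≺ e) ≡ true ⊎ e ≡ f
  ≺-connex e@(a , x) f@(b , y) e⊀f with <-cmp (toℕ a) (toℕ b)
  ... | tri< a<b _ _ = inj₁ (≺-by-colour f e a<b)
  ... | tri> _ _ b<a = ⊥-elim (≡false⇒≢true e⊀f (≺-by-colour e f b<a))
  ... | tri≈ _ a≡b _ with <-cmp (toℕ x) (toℕ y)
  ...   | tri< x<y _ _ = inj₁ (≺-within-colour f e (sym a≡b) x<y)
  ...   | tri> _ _ y<x = ⊥-elim (≡false⇒≢true e⊀f (≺-within-colour e f a≡b y<x))
  ...   | tri≈ _ x≡y _ = inj₂ (cong₂ _,_ (toℕ-injective a≡b) (toℕ-injective x≡y))

  ≺-≼-trans : ∀ e f g → (e ≺ f) ≡ true → not (g ≺ f) ≡ true → (e ≺ g) ≡ true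
  ≺-≼-trans e f g e≺f f≼g with ≺-connex g f (not-injective f≼g)
  ... | inj₁ f≺g = ≺-trans e f g e≺f f≺g
  ... | inj₂ refl = e≺f

-- Pinnacles of words

module _ {m n : ℕ} where

  private
    E = Elt m n

  open import Data.List.Membership.DecPropositional (_≟E_ {m} {n}) using (_∈?_)

  Ascending : List E → Set
  Ascending (x ∷ y ∷ r) = ((x ≺ y) ≡ true) × Ascending (y ∷ r)
  Ascending _ = ⊤

  Below : List E → List E → Set
  Below _ [] = ⊤
  Below [] (_ ∷ _) = ⊥
  Below (v ∷ vs) (p ∷ ps) = ((v ≺ p) ≡ true) × Below vs ps

  interleave : List E → List E → List E
  interleave [] ps = ps
  interleave (v ∷ vs) [] = v ∷ vs
  interleave (v ∷ vs) (p ∷ ps) = v ∷ p ∷ interleave vs ps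

  pinList-ascending : ∀ xs → Ascending xs → pinList xs ≡ []
  pinList-ascending [] _ = refl
  pinList-ascending (x ∷ []) _ = refl
  pinList-ascending (x ∷ y ∷ []) _ = refl
  pinList-ascending (x ∷ y ∷ z ∷ r) (_ , y≺z , asc) = trans y-no-peak (pinList-ascending (y ∷ z ∷ r) (y≺z , asc))
    where
    y-no-peak : pinList (x ∷ y ∷ z ∷ r) ≡ pinList (y ∷ z ∷ r)
    y-no-peak rewrite ≺-asym y z y≺z | ∧-zeroʳ (x ≺ y) = refl

  interleave-head : ∀ v vs ps → ∃ λ R → interleave (v ∷ vs) ps ≡ v ∷ R
  interleave-head v vs [] = vs , refl
  interleave-head v vs (p ∷ ps) = _ , refl

  pinList-interleave : ∀ v vs ps → Ascending (v ∷ vs) → Below vs ps → pinList (interleave (v ∷ vs) ps) ≡ ps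
  pinList-interleave v vs [] asc _ = pinList-ascending (v ∷ vs) asc
  pinList-interleave v (v′ ∷ vs) (p ∷ ps) (v≺v′ , asc) (v′≺p , below)
    with interleave (v′ ∷ vs) ps | interleave-head v′ vs ps | pinList-interleave v′ vs ps asc below
  ... | .(v′ ∷ R) | R , refl | pins≡ps rewrite ≺-trans v v′ p v≺v′ v′≺p | v′≺p =
    cong (p ∷_) (trans (drop-peak R) pins≡ps)
    where
    drop-peak : ∀ R → pinList (p ∷ v′ ∷ R) ≡ pinList (v′ ∷ R)
    drop-peak [] = refl
    drop-peak (_ ∷ _) rewrite ≺-asym v′ p v′≺p = refl

  Below-++ʳ : ∀ xs ys zs → Below xs ys → Below (xs ++ zs) ys
  Below-++ʳ xs [] zs _ = tt
  Below-++ʳ (x ∷ xs) (y ∷ ys) zs (x≺y , below) = x≺y , Below-++ʳ xs ys zs below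

  Below-all : ∀ xs zs → length zs ≤ length xs → All (λ v → All (λ o → (v ≺ o) ≡ true) zs) xs → Below xs zs
  Below-all xs [] _ _ = tt
  Below-all (x ∷ xs) (z ∷ zs) (s≤s len) ((x≺z ∷ _) ∷ all) = x≺z , Below-all xs zs len (All.map All.tail all)

  Below-++ : ∀ xs ys zs → Below xs ys → length ys + length zs ≤ length xs →
             All (λ v → All (λ o → (v ≺ o) ≡ true) zs) xs → Below xs (ys ++ zs)
  Below-++ xs [] zs _ len all = Below-all xs zs len all
  Below-++ (x ∷ xs) (y ∷ ys) zs (x≺y , below) (s≤s len) (_ ∷ all) = x≺y , Below-++ xs ys zs below len all

  Ascending-∷ʳ : ∀ xs z → Ascending xs → All (λ v → (v ≺ z) ≡ true) xs → Ascending (xs ++ [ z ])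
  Ascending-∷ʳ [] z _ _ = tt
  Ascending-∷ʳ (x ∷ []) z _ (x≺z ∷ _) = x≺z , tt
  Ascending-∷ʳ (x ∷ y ∷ r) z (x≺y , asc) (_ ∷ all) = x≺y , Ascending-∷ʳ (y ∷ r) z asc all

  peaks : E → List E → List Bool
  peaks a [] = []
  peaks a (y ∷ []) = false ∷ []
  peaks a (y ∷ z ∷ r) = ((a ≺ y) ∧ (z ≺ y)) ∷ peaks y (z ∷ r)

  length-peaks : ∀ a L → length (peaks a L) ≡ length L
  length-peaks a [] = refl
  length-peaks a (y ∷ []) = refl
  length-peaks a (y ∷ z ∷ r) = cong suc (length-peaks y (z ∷ r))

  select : List E → List Bool → List E
  select (x ∷ xs) (b ∷ bs) = if b then x ∷ select xs bs else select xs bs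
  select _ _ = []

  pinList≡select-peaks : ∀ x r → pinList (x ∷ r) ≡ select r (peaks x r)
  pinList≡select-peaks x [] = refl
  pinList≡select-peaks x (y ∷ []) = refl
  pinList≡select-peaks x (y ∷ z ∷ r) rewrite pinList≡select-peaks y (z ∷ r) = refl

  countFlagged : (E → Bool → Bool) → List E → List Bool → ℕ
  countFlagged q (x ∷ xs) (b ∷ bs) = 𝟙 (q x b) + countFlagged q xs bs
  countFlagged q _ _ = 0

  module _ (t : E) where

    #nonPeaks≺ #peaks≼ : E → List E → ℕ
    #nonPeaks≺ a L = countFlagged (λ e f → not f ∧ (e ≺ t)) L (peaks a L)
    #peaks≼ a L = countFlagged (λ e f → f ∧ not (t ≺ e)) L (peaks a L)

    #peaks≼≤#nonPeaks≺ : ∀ a L → #peaks≼ a L ≤ #nonPeaks≺ a L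
    #peaks≼≤#nonPeaks≺ a [] = z≤n
    #peaks≼≤#nonPeaks≺ a (y ∷ []) = z≤n
    #peaks≼≤#nonPeaks≺ a (y ∷ z ∷ []) with (a ≺ y) ∧ (z ≺ y) in peak | not (t ≺ y) in t-vs-y
    ... | false | _ = z≤n
    ... | true | false = z≤n
    ... | true | true rewrite ≺-≼-trans z y t (proj₂ (∧≡true⇒ {a ≺ y} peak)) t-vs-y = ≤-refl
    #peaks≼≤#nonPeaks≺ a (y ∷ z ∷ w ∷ r) = step (#peaks≼≤#nonPeaks≺ y (z ∷ w ∷ r)) (#peaks≼≤#nonPeaks≺ z (w ∷ r))
      where
      step : #peaks≼ y (z ∷ w ∷ r) ≤ #nonPeaks≺ y (z ∷ w ∷ r) → #peaks≼ z (w ∷ r) ≤ #nonPeaks≺ z (w ∷ r) →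
             #peaks≼ a (y ∷ z ∷ w ∷ r) ≤ #nonPeaks≺ a (y ∷ z ∷ w ∷ r)
      step from-y from-z with (a ≺ y) ∧ (z ≺ y) in peak | not (t ≺ y) in t-vs-y
      ... | true | true rewrite ≺-asym z y (proj₂ (∧≡true⇒ {a ≺ y} peak)) | ≺-≼-trans z y t (proj₂ (∧≡true⇒ {a ≺ y} peak)) t-vs-y =
        s≤s from-z
      ... | true | false = from-y
      ... | false | _ = ≤-trans from-y (m≤n+m _ (𝟙 (y ≺ t)))

    #peaks≼<#nonPeaks≺ : ∀ y z r → (z ≺ y) ≡ true → not (t ≺ y) ≡ true → #peaks≼ y (z ∷ r) < #nonPeaks≺ y (z ∷ r)
    #peaks≼<#nonPeaks≺ y z [] z≺y y≼t rewrite ≺-≼-trans z y t z≺y y≼t = ≤-refl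
    #peaks≼<#nonPeaks≺ y z (w ∷ r) z≺y y≼t rewrite ≺-asym z y z≺y | ≺-≼-trans z y t z≺y y≼t =
      s≤s (#peaks≼≤#nonPeaks≺ z (w ∷ r))

    -- Each pinnacle ≼ t is followed by a non-pinnacle ≺ t, and the leftmost one is also preceded by one.
    pinnacle-ballot : ∀ a L → 1 ≤ #peaks≼ a L → suc (#peaks≼ a L) ≤ 𝟙 (a ≺ t) + #nonPeaks≺ a L
    pinnacle-ballot a (y ∷ z ∷ r) = step (pinnacle-ballot y (z ∷ r))
      where
      step : (1 ≤ #peaks≼ y (z ∷ r) → suc (#peaks≼ y (z ∷ r)) ≤ 𝟙 (y ≺ t) + #nonPeaks≺ y (z ∷ r)) →
             1 ≤ #peaks≼ a (y ∷ z ∷ r) → suc (#peaks≼ a (y ∷ z ∷ r)) ≤ 𝟙 (a ≺ t) + #nonPeaks≺ a (y ∷ z ∷ r)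
      step from-y h with (a ≺ y) ∧ (z ≺ y) in peak | not (t ≺ y) in t-vs-y
      ... | true | true rewrite ≺-≼-trans a y t (proj₁ (∧≡true⇒ {a ≺ y} peak)) t-vs-y =
        s≤s (#peaks≼<#nonPeaks≺ y z r (proj₂ (∧≡true⇒ {a ≺ y} peak)) t-vs-y)
      ... | true | false rewrite ≺-asym t y (not-injective t-vs-y) = ≤-trans (from-y h) (m≤n+m _ (𝟙 (a ≺ t)))
      ... | false | _ = ≤-trans (from-y h) (m≤n+m _ (𝟙 (a ≺ t)))

  select-⊆ : ∀ {e} xs bs → e ∈ select xs bs → e ∈ xs
  select-⊆ (x ∷ xs) (true ∷ bs) (here refl) = here refl
  select-⊆ (x ∷ xs) (true ∷ bs) (there e∈) = there (select-⊆ xs bs e∈)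
  select-⊆ (x ∷ xs) (false ∷ bs) e∈ = there (select-⊆ xs bs e∈)

  Unique-map-select : ∀ (f : E → B) xs bs → Unique (map f xs) → Unique (map f (select xs bs))
  Unique-map-select f [] bs _ = []
  Unique-map-select f (x ∷ xs) [] _ = []
  Unique-map-select f (x ∷ xs) (true ∷ bs) (x∉ ∷ uniq) =
    All.map⁺ (All.anti-mono (select-⊆ xs bs) (All.map⁻ x∉)) ∷ Unique-map-select f xs bs uniq
  Unique-map-select f (x ∷ xs) (false ∷ bs) (_ ∷ uniq) = Unique-map-select f xs bs uniq

  countFlagged-select : ∀ (q : E → Bool) xs bs → countFlagged (λ e f → f ∧ q e) xs bs ≡ count q (select xs bs)
  countFlagged-select q [] bs = refl
  countFlagged-select q (x ∷ xs) [] = refl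
  countFlagged-select q (x ∷ xs) (false ∷ bs) = countFlagged-select q xs bs
  countFlagged-select q (x ∷ xs) (true ∷ bs) = cong (𝟙 (q x) +_) (countFlagged-select q xs bs)

  countFlagged-unselected : ∀ (q : E → Bool) xs bs → Unique xs → length bs ≡ length xs →
    countFlagged (λ e f → not f ∧ q e) xs bs ≡ count (λ e → not (does (e ∈? select xs bs)) ∧ q e) xs
  countFlagged-unselected q [] [] _ _ = refl
  countFlagged-unselected q (x ∷ xs) (b ∷ bs) (x∉ ∷ uniq) len = cong₂ _+_
    (cong (λ c → 𝟙 (not c ∧ q x)) (sym (x∈?≡b b)))
    (trans (countFlagged-unselected q xs bs uniq (suc-injective len)) (count-cong-∈ xs (other∈? b)))
    where
    x∉xs : x ∉ xs
    x∉xs = All¬⇒¬Any x∉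
    x∈?≡b : ∀ b → does (x ∈? select (x ∷ xs) (b ∷ bs)) ≡ b
    x∈?≡b true = dec-true (x ∈? (x ∷ select xs bs)) (here refl)
    x∈?≡b false = dec-false (x ∈? select xs bs) (x∉xs ∘ select-⊆ xs bs)
    other∈? : ∀ b {e} → e ∈ xs → (not (does (e ∈? select xs bs)) ∧ q e) ≡ (not (does (e ∈? select (x ∷ xs) (b ∷ bs))) ∧ q e)
    other∈? false e∈ = refl
    other∈? true {e} e∈ with e ≟E x
    ... | yes refl = ⊥-elim (x∉xs e∈)
    ... | no _ = refl

  countFlagged-mono : ∀ (q q′ : E → Bool → Bool) xs bs → (∀ e f → q e f ≡ true → q′ e f ≡ true) →
    countFlagged q xs bs ≤ countFlagged q′ xs bs
  countFlagged-mono q q′ [] bs _ = z≤n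
  countFlagged-mono q q′ (x ∷ xs) [] _ = z≤n
  countFlagged-mono q q′ (x ∷ xs) (b ∷ bs) q⇒q′ with q x b in qxb | q′ x b in q′xb
  ... | true | true = s≤s (countFlagged-mono q q′ xs bs q⇒q′)
  ... | true | false = ⊥-elim (≡false⇒≢true q′xb (q⇒q′ x b qxb))
  ... | false | _ = ≤-trans (countFlagged-mono q q′ xs bs q⇒q′) (m≤n+m _ _)

  countFlagged-split : ∀ xs bs → length bs ≡ length xs →
    countFlagged (λ e f → f ∧ true) xs bs + countFlagged (λ e f → not f) xs bs ≡ length xs
  countFlagged-split [] [] _ = refl
  countFlagged-split (x ∷ xs) (true ∷ bs) len = cong suc (countFlagged-split xs bs (suc-injective len))
  countFlagged-split (x ∷ xs) (false ∷ bs) len = trans (+-suc _ _) (cong suc (countFlagged-split xs bs (suc-injective len)))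

  colourOf : List E → Fin n → Maybe (Fin m)
  colourOf [] y = nothing
  colourOf (e ∷ L) y = if does (proj₂ e ≟ᶠ y) then just (proj₁ e) else colourOf L y

  colourOf-∉ : ∀ L y → y ∉ map proj₂ L → colourOf L y ≡ nothing
  colourOf-∉ [] y _ = refl
  colourOf-∉ (e ∷ L) y y∉ with proj₂ e ≟ᶠ y
  ... | yes refl = ⊥-elim (y∉ (here refl))
  ... | no _ = colourOf-∉ L y (y∉ ∘ there)

  colourOf⇒∈ : ∀ L y c → colourOf L y ≡ just c → (c , y) ∈ L
  colourOf⇒∈ (e ∷ L) y c h with proj₂ e ≟ᶠ y
  colourOf⇒∈ ((c , y) ∷ L) y c refl | yes refl = here refl
  ... | no _ = there (colourOf⇒∈ L y c h)

  ∈⇒colourOf : ∀ U → Unique (map proj₂ U) → ∀ {c y} → (c , y) ∈ U → colourOf U y ≡ just c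
  ∈⇒colourOf (u ∷ U) _ (here refl) rewrite dec-true (proj₂ u ≟ᶠ proj₂ u) refl = refl
  ∈⇒colourOf (u ∷ U) (u∉ ∷ uniq) {c} {y} (there cy∈) with proj₂ u ≟ᶠ y
  ... | yes refl = ⊥-elim (All¬⇒¬Any u∉ (∈.∈-map⁺ proj₂ cy∈))
  ... | no _ = ∈⇒colourOf U uniq cy∈

  onLetter : (E → Bool) → Maybe (Fin m) → Fin n → Bool
  onLetter R nothing y = false
  onLetter R (just c) y = R (c , y)

  count≡∑-colourOf : ∀ (R : E → Bool) U → Unique (map proj₂ U) → count R U ≡ ∑[ y < n ] 𝟙 (onLetter R (colourOf U y) y)
  count≡∑-colourOf R [] _ = sym (sum-replicate-zero n)
  count≡∑-colourOf R (u ∷ U) (u∉ ∷ uniq) = begin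
    𝟙 (R u) + count R U
      ≡⟨ cong₂ _+_ (sym (∑-𝟙-≟ (proj₂ u) (λ _ → R u))) (count≡∑-colourOf R U uniq) ⟩
    ∑[ y < n ] 𝟙 (does (proj₂ u ≟ᶠ y) ∧ R u) + ∑[ y < n ] 𝟙 (onLetter R (colourOf U y) y)
      ≡⟨ sym (∑-distrib-+ {n} (λ y → 𝟙 (does (proj₂ u ≟ᶠ y) ∧ R u)) (λ y → 𝟙 (onLetter R (colourOf U y) y))) ⟩
    ∑[ y < n ] (𝟙 (does (proj₂ u ≟ᶠ y) ∧ R u) + 𝟙 (onLetter R (colourOf U y) y))
      ≡⟨ sum-cong-≗ {n} at ⟩
    ∑[ y < n ] 𝟙 (onLetter R (colourOf (u ∷ U) y) y) ∎
    where
    open ≡-Reasoning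
    at : ∀ y → 𝟙 (does (proj₂ u ≟ᶠ y) ∧ R u) + 𝟙 (onLetter R (colourOf U y) y) ≡ 𝟙 (onLetter R (colourOf (u ∷ U) y) y)
    at y with proj₂ u ≟ᶠ y
    ... | yes refl rewrite colourOf-∉ U (proj₂ u) (All¬⇒¬Any u∉) = +-identityʳ _
    ... | no _ = refl

  ⌊≟E⌋ : ∀ (a b : Fin m) (x y : Fin n) → ⌊ (a , x) ≟E (b , y) ⌋ ≡ does (a ≟ᶠ b) ∧ does (x ≟ᶠ y)
  ⌊≟E⌋ a b x y with a ≟ᶠ b
  ... | no _ = refl
  ... | yes refl with x ≟ᶠ y
  ...   | yes _ = refl
  ...   | no _ = refl

  any-≟E-∉ : ∀ (U : List E) a x → x ∉ map proj₂ U → any (λ e → ⌊ (a , x) ≟E e ⌋) U ≡ false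
  any-≟E-∉ [] a x _ = refl
  any-≟E-∉ (u ∷ U) a x x∉ rewrite ⌊≟E⌋ a (proj₁ u) x (proj₂ u) | dec-false (x ≟ᶠ proj₂ u) (x∉ ∘ here) | ∧-zeroʳ (does (a ≟ᶠ proj₁ u)) =
    any-≟E-∉ U a x (x∉ ∘ there)

  any-≟E≡hasColour : ∀ U → Unique (map proj₂ U) → ∀ a x →
    any (λ e → ⌊ (a , x) ≟E e ⌋) U ≡ hasColour a (colourOf U x)
  any-≟E≡hasColour [] _ a x = refl
  any-≟E≡hasColour (u ∷ U) (u∉ ∷ uniq) a x with proj₂ u ≟ᶠ x
  ... | yes refl rewrite ⌊≟E⌋ a (proj₁ u) (proj₂ u) (proj₂ u) | dec-true (proj₂ u ≟ᶠ proj₂ u) refl | any-≟E-∉ U a (proj₂ u) (All¬⇒¬Any u∉) =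
    trans (∨-identityʳ _) (∧-identityʳ _)
  ... | no u≢x rewrite ⌊≟E⌋ a (proj₁ u) x (proj₂ u) | dec-false (x ≟ᶠ proj₂ u) (u≢x ∘ sym) | ∧-zeroʳ (does (a ≟ᶠ proj₁ u)) = any-≟E≡hasColour U uniq a x

  codeOf : List E → Code m
  codeOf U = tabulate (colourOf U)

  size-codeOf : ∀ U → Unique (map proj₂ U) → size (codeOf U) ≡ length U
  size-codeOf U uniq = begin
    size (codeOf U)                                         ≡⟨ count-tabulate is-just (colourOf U) ⟩
    ∑[ y < n ] 𝟙 (is-just (colourOf U y))                   ≡⟨ sum-cong-≗ {n} (λ y → cong 𝟙 (is-just≡onLetter (colourOf U y) y)) ⟩
    ∑[ y < n ] 𝟙 (onLetter (λ _ → true) (colourOf U y) y)   ≡⟨ count≡∑-colourOf (λ _ → true) U uniq ⟨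
    count (λ _ → true) U                                    ≡⟨ count-true U ⟩
    length U                                                ∎
    where
    open ≡-Reasoning
    is-just≡onLetter : ∀ h y → is-just h ≡ onLetter (λ _ → true) h y
    is-just≡onLetter nothing y = refl
    is-just≡onLetter (just _) y = refl

Unique-map-pinList : ∀ {m n} (W : List (Elt m n)) → Unique (map proj₂ W) → Unique (map proj₂ (pinList W))
Unique-map-pinList [] _ = []
Unique-map-pinList (x₀ ∷ L) (_ ∷ uniq) rewrite pinList≡select-peaks x₀ L = Unique-map-select proj₂ L (peaks x₀ L) uniq

-- Pinnacle codes of words are admissible

ballot-tabulate : ∀ {k n} (f : Fin n → Maybe (Fin (suc k))) →
  (∀ x → isLowest (f x) ≡ true →
     ∑[ y < n ] 𝟙 ((toℕ x <ᵇ toℕ y) ∧ isLowest (f y)) + 2 ≤ ∑[ y < n ] 𝟙 ((toℕ x <ᵇ toℕ y) ∧ is-nothing (f y))) →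
  ballot (tabulate f) ≡ true
ballot-tabulate {n = zero} f room = refl
ballot-tabulate {n = suc n} f room with f zero in f0 | ballot-tabulate (f ∘ suc) (room ∘ suc)
... | nothing | rest = rest
... | just c | rest with isLowest (just c) in lowest
...   | false rewrite rest = refl
...   | true rewrite rest | count-tabulate isLowest (f ∘ suc) | count-tabulate is-nothing (f ∘ suc) =
  ≤⇒≤ᵇ≡true (room zero (trans (cong isLowest f0) lowest))

module _ {k n : ℕ} where

  private
    E = Elt (suc k) n

  open import Data.List.Membership.DecPropositional (_≟E_ {suc k} {n}) using (_∈?_)

  ⊀-lowest : ∀ (t e : E) → toℕ (proj₁ t) ≡ k →
    not (t ≺ e) ≡ ((toℕ (proj₂ t) ≤ᵇ toℕ (proj₂ e)) ∧ isLowest (just (proj₁ e)))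
  ⊀-lowest (c , x) (c′ , y) c≡k with m≤n⇒m<n∨m≡n (toℕ≤pred[n] c′)
  ... | inj₁ c′<k rewrite c≡k | <⇒<ᵇ≡true c′<k | ≢⇒≡ᵇ≡false (<⇒≢ c′<k) = sym (∧-zeroʳ _)
  ... | inj₂ c′≡k rewrite c≡k | c′≡k | ≮⇒<ᵇ≡false (<-irrefl (refl {x = k})) | ≡⇒≡ᵇ≡true (refl {x = k}) =
    trans (not-<ᵇ (toℕ x) (toℕ y)) (sym (∧-identityʳ _))

  ≺-lowest⇒< : ∀ (e t : E) → toℕ (proj₁ t) ≡ k → (e ≺ t) ≡ true → toℕ (proj₂ t) < toℕ (proj₂ e)
  ≺-lowest⇒< e t t≡k e≺t with ≺⇒⊏ e t e≺t
  ... | inj₁ t<e = ⊥-elim (<⇒≱ t<e (subst (toℕ (proj₁ e) ≤_) (sym t≡k) (toℕ≤pred[n] (proj₁ e))))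
  ... | inj₂ (_ , y<x) = y<x

  module PinnaclesOfWord (x₀ : E) (L : List E) (uniq : Unique (map proj₂ (x₀ ∷ L))) where

    pins : List E
    pins = select L (peaks x₀ L)

    uniq-pins : Unique (map proj₂ pins)
    uniq-pins = Unique-map-select proj₂ L (peaks x₀ L) (AllPairs.tail uniq)

    #peaks≼-lowest : ∀ {c x} → toℕ c ≡ k → colourOf pins x ≡ just c →
      #peaks≼ (c , x) x₀ L ≡ suc (∑[ y < n ] 𝟙 ((toℕ x <ᵇ toℕ y) ∧ isLowest (colourOf pins y)))
    #peaks≼-lowest {c} {x} c≡k pin = begin
      #peaks≼ (c , x) x₀ L
        ≡⟨ countFlagged-select (λ e → not ((c , x) ≺ e)) L (peaks x₀ L) ⟩
      count (λ e → not ((c , x) ≺ e)) pins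
        ≡⟨ count≡∑-colourOf _ pins uniq-pins ⟩
      ∑[ y < n ] 𝟙 (onLetter (λ e → not ((c , x) ≺ e)) (colourOf pins y) y)
        ≡⟨ sum-cong-≗ {n} (λ y → cong 𝟙 (weakly-below y (colourOf pins y))) ⟩
      ∑[ y < n ] 𝟙 ((toℕ x ≤ᵇ toℕ y) ∧ isLowest (colourOf pins y))
        ≡⟨ sum-cong-≗ {n} (λ y → 𝟙-≤ᵇ-split x y _) ⟩
      ∑[ y < n ] (𝟙 (does (x ≟ᶠ y) ∧ isLowest (colourOf pins y)) + 𝟙 ((toℕ x <ᵇ toℕ y) ∧ isLowest (colourOf pins y)))
        ≡⟨ ∑-distrib-+ {n} (λ y → 𝟙 (does (x ≟ᶠ y) ∧ isLowest (colourOf pins y))) _ ⟩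
      ∑[ y < n ] 𝟙 (does (x ≟ᶠ y) ∧ isLowest (colourOf pins y)) + ∑[ y < n ] 𝟙 ((toℕ x <ᵇ toℕ y) ∧ isLowest (colourOf pins y))
        ≡⟨ cong (_+ ∑[ y < n ] 𝟙 ((toℕ x <ᵇ toℕ y) ∧ isLowest (colourOf pins y)))
                (trans (∑-𝟙-≟ x (isLowest ∘ colourOf pins)) (cong 𝟙 (trans (cong isLowest pin) (≡⇒≡ᵇ≡true c≡k)))) ⟩
      suc (∑[ y < n ] 𝟙 ((toℕ x <ᵇ toℕ y) ∧ isLowest (colourOf pins y))) ∎
      where
      open ≡-Reasoning
      weakly-below : ∀ y h → onLetter (λ e → not ((c , x) ≺ e)) h y ≡ ((toℕ x ≤ᵇ toℕ y) ∧ isLowest h)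
      weakly-below y nothing = sym (∧-zeroʳ _)
      weakly-below y (just c′) = ⊀-lowest (c , x) (c′ , y) c≡k

    #nonPeaks≺-lowest : ∀ {c x} → toℕ c ≡ k →
      𝟙 (x₀ ≺ (c , x)) + #nonPeaks≺ (c , x) x₀ L ≤ ∑[ y < n ] 𝟙 ((toℕ x <ᵇ toℕ y) ∧ is-nothing (colourOf pins y))
    #nonPeaks≺-lowest {c} {x} c≡k = begin
      countFlagged (λ e f → not f ∧ (e ≺ (c , x))) (x₀ ∷ L) (false ∷ peaks x₀ L)
        ≡⟨ countFlagged-unselected (_≺ (c , x)) (x₀ ∷ L) (false ∷ peaks x₀ L) (Unique.map⁻ uniq) (cong suc (length-peaks x₀ L)) ⟩
      count R (x₀ ∷ L)
        ≡⟨ count≡∑-colourOf R (x₀ ∷ L) uniq ⟩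
      ∑[ y < n ] 𝟙 (onLetter R (colourOf (x₀ ∷ L) y) y)
        ≤⟨ ∑-mono-≤ (λ y → 𝟙-mono (later-hole y (colourOf (x₀ ∷ L) y) refl)) ⟩
      ∑[ y < n ] 𝟙 ((toℕ x <ᵇ toℕ y) ∧ is-nothing (colourOf pins y)) ∎
      where
      open ≤-Reasoning
      R : E → Bool
      R e = not (does (e ∈? pins)) ∧ (e ≺ (c , x))
      later-hole : ∀ y h → colourOf (x₀ ∷ L) y ≡ h → onLetter R h y ≡ true → ((toℕ x <ᵇ toℕ y) ∧ is-nothing (colourOf pins y)) ≡ true
      later-hole y (just c′) letter Rc′y with ∧≡true⇒ {not (does ((c′ , y) ∈? pins))} Rc′y
      ... | non-pin , c′y≺cx = cong₂ _∧_ (<⇒<ᵇ≡true (≺-lowest⇒< (c′ , y) (c , x) c≡k c′y≺cx)) hole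
        where
        hole : is-nothing (colourOf pins y) ≡ true
        hole with colourOf pins y in pin
        ... | nothing = refl
        ... | just c″ with trans (sym letter) (∈⇒colourOf (x₀ ∷ L) uniq (there (select-⊆ L (peaks x₀ L) (colourOf⇒∈ pins y c″ pin))))
        ...   | refl = ⊥-elim (≡false⇒≢true (cong not (dec-true ((c′ , y) ∈? pins) (colourOf⇒∈ pins y c″ pin))) non-pin)

    ballot-room : ∀ x → isLowest (colourOf pins x) ≡ true →
      ∑[ y < n ] 𝟙 ((toℕ x <ᵇ toℕ y) ∧ isLowest (colourOf pins y)) + 2 ≤ ∑[ y < n ] 𝟙 ((toℕ x <ᵇ toℕ y) ∧ is-nothing (colourOf pins y))
    ballot-room x lowest with colourOf pins x in pin
    ... | just c = begin
      later + 2                                 ≡⟨ +-comm later 2 ⟩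
      suc (suc later)                           ≡⟨ cong suc #peaks≼≡ ⟨
      suc (#peaks≼ (c , x) x₀ L)            ≤⟨ pinnacle-ballot (c , x) x₀ L (subst (1 ≤_) (sym #peaks≼≡) (s≤s z≤n)) ⟩
      𝟙 (x₀ ≺ (c , x)) + #nonPeaks≺ (c , x) x₀ L ≤⟨ #nonPeaks≺-lowest c≡k ⟩
      ∑[ y < n ] 𝟙 ((toℕ x <ᵇ toℕ y) ∧ is-nothing (colourOf pins y)) ∎
      where
      open ≤-Reasoning
      later = ∑[ y < n ] 𝟙 ((toℕ x <ᵇ toℕ y) ∧ isLowest (colourOf pins y))
      c≡k : toℕ c ≡ k
      c≡k = ≡ᵇ≡true⇒≡ lowest
      #peaks≼≡ : #peaks≼ (c , x) x₀ L ≡ suc later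
      #peaks≼≡ = #peaks≼-lowest c≡k pin

    size-bound : length (x₀ ∷ L) ≡ n → 2 * length pins ≤ n ∸ 1
    size-bound len with length pins in #pins
    ... | zero = z≤n
    ... | suc p = begin
      2 * suc p              ≡⟨ solve 1 (λ p → con 2 :* (con 1 :+ p) := p :+ (p :+ con 2)) refl p ⟩
      p + (p + 2)            ≤⟨ +-monoʳ-≤ p (begin
        p + 2                  ≡⟨ +-comm p 2 ⟩
        suc (suc p)            ≡⟨ cong suc (trans #peaks≼t₀ #pins) ⟨
        suc (#peaks≼ t₀ x₀ L) ≤⟨ pinnacle-ballot t₀ x₀ L (subst (1 ≤_) (sym (trans #peaks≼t₀ #pins)) (s≤s z≤n)) ⟩
        𝟙 (x₀ ≺ t₀) + #nonPeaks≺ t₀ x₀ L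
          ≤⟨ countFlagged-mono _ (λ e f → not f) (x₀ ∷ L) (false ∷ peaks x₀ L) (λ e f h → proj₁ (∧≡true⇒ {not f} h)) ⟩
        nonPeaks               ∎) ⟩
      p + nonPeaks           ≡⟨ cong (_∸ 1) (trans (cong (_+ nonPeaks) (sym #pins)) split) ⟩
      n ∸ 1                  ∎
      where
      open ≤-Reasoning
      0<n : 0 < n
      0<n = ≤-trans (s≤s z≤n) (toℕ<n (proj₂ x₀))
      -- the largest element ξ⁰(1), so every pinnacle is ≼ t₀
      t₀ : E
      t₀ = (zero , fromℕ< 0<n)
      ≼t₀ : ∀ e → not (t₀ ≺ e) ≡ true
      ≼t₀ (c′ , y) rewrite toℕ-fromℕ< 0<n = cong not (∧-zeroʳ (0 ≡ᵇ toℕ c′))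
      #peaks≼t₀ : #peaks≼ t₀ x₀ L ≡ length pins
      #peaks≼t₀ = trans (countFlagged-select _ L (peaks x₀ L)) (trans (count-cong pins ≼t₀) (count-true pins))
      nonPeaks = countFlagged (λ e f → not f) (x₀ ∷ L) (false ∷ peaks x₀ L)
      split : length pins + nonPeaks ≡ n
      split = begin-equality
        length pins + nonPeaks  ≡⟨ cong (_+ nonPeaks) (trans (sym (count-true pins)) (sym (countFlagged-select _ (x₀ ∷ L) (false ∷ peaks x₀ L)))) ⟩
        countFlagged (λ e f → f ∧ true) (x₀ ∷ L) (false ∷ peaks x₀ L) + nonPeaks
                                ≡⟨ countFlagged-split (x₀ ∷ L) (false ∷ peaks x₀ L) (cong suc (length-peaks x₀ L)) ⟩
        length (x₀ ∷ L)         ≡⟨ len ⟩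
        n                       ∎

  admissible-pinList : ∀ W → Unique (map proj₂ W) → length W ≡ n → admissible (codeOf (pinList W)) ≡ true
  admissible-pinList [] _ _ =
    cong₂ _∧_ (ballot-tabulate (colourOf {suc k} {n} []) (λ _ ()))
              (≤⇒≤ᵇ≡true (subst₂ (λ s l → 2 * s ≤ l ∸ 1) (sym (size-codeOf {suc k} {n} [] [])) (sym (List.length-tabulate (colourOf {suc k} {n} []))) z≤n))
  admissible-pinList (x₀ ∷ L) uniq len rewrite pinList≡select-peaks x₀ L = cong₂ _∧_
    (ballot-tabulate (colourOf pins) ballot-room)
    (≤⇒≤ᵇ≡true (subst₂ (λ s l → 2 * s ≤ l ∸ 1) (sym (size-codeOf pins uniq-pins)) (sym (List.length-tabulate (colourOf pins))) (size-bound len)))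
    where open PinnaclesOfWord x₀ L uniq

colourAt : ∀ {m} → Code m → ℕ → Maybe (Fin m)
colourAt [] _ = nothing
colourAt (h ∷ S) zero = h
colourAt (h ∷ S) (suc i) = colourAt S i

subsetOf : ∀ {m} n → Code m → SubsetI m n
subsetOf n S = Vec.tabulate λ a → Vec.tabulate λ x → hasColour a (colourAt S (toℕ x))

colourAt-tabulate : ∀ {m n} (f : Fin n → Maybe (Fin m)) x → colourAt (tabulate f) (toℕ x) ≡ f x
colourAt-tabulate f zero = refl
colourAt-tabulate f (suc x) = colourAt-tabulate (f ∘ suc) x

toSubsetI≡subsetOf : ∀ {m n} (U : List (Elt m n)) → Unique (map proj₂ U) → toSubsetI U ≡ subsetOf n (codeOf U)
toSubsetI≡subsetOf U uniq = Vec.tabulate-cong λ a → Vec.tabulate-cong λ x →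
  trans (any-≟E≡hasColour U uniq a x) (cong (hasColour a) (sym (colourAt-tabulate (colourOf U) x)))

tabulate-colourAt : ∀ {m} n (S : Code m) → length S ≡ n → tabulate (λ (x : Fin n) → colourAt S (toℕ x)) ≡ S
tabulate-colourAt zero [] _ = refl
tabulate-colourAt (suc n) (h ∷ S) len = cong (h ∷_) (tabulate-colourAt n S (suc-injective len))

card-tabulate : ∀ {m n} (R : Fin m → Subset n) → card (Vec.tabulate R) ≡ ∑[ a < m ] ∣ R a ∣
card-tabulate {zero} R = refl
card-tabulate {suc m} R = cong (∣ R zero ∣ +_) (card-tabulate (R ∘ suc))

∣tabulate∣ : ∀ {n} (g : Fin n → Bool) → ∣ Vec.tabulate g ∣ ≡ ∑[ x < n ] 𝟙 (g x)
∣tabulate∣ {zero} g = refl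
∣tabulate∣ {suc n} g with g zero
... | true = cong suc (∣tabulate∣ (g ∘ suc))
... | false = ∣tabulate∣ (g ∘ suc)

∑-hasColour : ∀ {m} (h : Maybe (Fin m)) → ∑[ a < m ] 𝟙 (hasColour a h) ≡ 𝟙 (is-just h)
∑-hasColour {m} nothing = sum-replicate-zero m
∑-hasColour {suc m} (just zero) = cong suc (sum-replicate-zero m)
∑-hasColour {suc m} (just (suc b)) = ∑-hasColour (just b)

card-subsetOf : ∀ {m} n (S : Code m) → length S ≡ n → card (subsetOf n S) ≡ size S
card-subsetOf {m} n S len = begin
  card (subsetOf n S)                                          ≡⟨ card-tabulate {m} {n} (λ a → Vec.tabulate (λ x → hasColour a (colourAt S (toℕ x)))) ⟩
  ∑[ a < m ] ∣ Vec.tabulate {n = n} (λ x → hasColour a (colourAt S (toℕ x))) ∣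
    ≡⟨ sum-cong-≗ {m} (λ a → ∣tabulate∣ {n} (λ x → hasColour a (colourAt S (toℕ x)))) ⟩
  ∑[ a < m ] ∑[ x < n ] 𝟙 (hasColour a (colourAt S (toℕ x)))  ≡⟨ ∑-comm {m} {n} (λ a x → 𝟙 (hasColour a (colourAt S (toℕ x)))) ⟩
  ∑[ x < n ] ∑[ a < m ] 𝟙 (hasColour a (colourAt S (toℕ x)))  ≡⟨ sum-cong-≗ {n} (λ x → ∑-hasColour (colourAt S (toℕ x))) ⟩
  ∑[ x < n ] 𝟙 (is-just (colourAt S (toℕ x)))                 ≡⟨ count-tabulate {n = n} is-just (λ x → colourAt S (toℕ x)) ⟨
  size (tabulate (λ (x : Fin n) → colourAt S (toℕ x)))         ≡⟨ cong size (tabulate-colourAt n S len) ⟩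
  size S                                                       ∎
  where open ≡-Reasoning

hasColour-injective : ∀ {m} (h h′ : Maybe (Fin m)) → (∀ a → hasColour a h ≡ hasColour a h′) → h ≡ h′
hasColour-injective nothing nothing _ = refl
hasColour-injective nothing (just c) same = ⊥-elim (≡false⇒≢true (sym (same c)) (dec-true (c ≟ᶠ c) refl))
hasColour-injective (just c) nothing same = ⊥-elim (≡false⇒≢true (same c) (dec-true (c ≟ᶠ c) refl))
hasColour-injective (just c) (just c′) same with c ≟ᶠ c′ | same c
... | yes refl | _ = refl
... | no _ | c≟c rewrite dec-true (c ≟ᶠ c) refl with () ← c≟c

subsetOf-injective : ∀ {m} n (S S′ : Code m) → length S ≡ n → length S′ ≡ n → subsetOf n S ≡ subsetOf n S′ → S ≡ S′
subsetOf-injective n S S′ len len′ same = begin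
  S                                                ≡⟨ tabulate-colourAt n S len ⟨
  tabulate (λ (x : Fin n) → colourAt S (toℕ x))    ≡⟨ List.tabulate-cong (λ x → hasColour-injective _ _ (λ a → entry a x)) ⟩
  tabulate (λ (x : Fin n) → colourAt S′ (toℕ x))   ≡⟨ tabulate-colourAt n S′ len′ ⟩
  S′                                               ∎
  where
  open ≡-Reasoning
  entry : ∀ a x → hasColour a (colourAt S (toℕ x)) ≡ hasColour a (colourAt S′ (toℕ x))
  entry a x = begin
    hasColour a (colourAt S (toℕ x))                      ≡⟨ lookup-subsetOf S ⟨
    Vec.lookup (Vec.lookup (subsetOf n S) a) x            ≡⟨ cong (λ P → Vec.lookup (Vec.lookup P a) x) same ⟩
    Vec.lookup (Vec.lookup (subsetOf n S′) a) x           ≡⟨ lookup-subsetOf S′ ⟩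
    hasColour a (colourAt S′ (toℕ x))                     ∎
    where
    lookup-subsetOf : ∀ T → Vec.lookup (Vec.lookup (subsetOf n T) a) x ≡ hasColour a (colourAt T (toℕ x))
    lookup-subsetOf T = trans (cong (λ row → Vec.lookup row x) (Vec.lookup∘tabulate _ a)) (Vec.lookup∘tabulate _ x)

-- Every admissible code is the pinnacle code of a word

lift : ∀ {m n} → Elt m n → Elt m (suc n)
lift (a , x) = (a , suc x)

lifts : ∀ {m n} → List (Elt m n) → List (Elt m (suc n))
lifts = map lift

module _ {m n : ℕ} where

  Ascending-lifts : ∀ (V : List (Elt m n)) → Ascending V → Ascending (lifts V)
  Ascending-lifts [] _ = tt
  Ascending-lifts (x ∷ []) _ = tt
  Ascending-lifts (x ∷ y ∷ V) (x≺y , asc) = x≺y , Ascending-lifts (y ∷ V) asc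

  Below-lifts : ∀ (V L : List (Elt m n)) → Below V L → Below (lifts V) (lifts L)
  Below-lifts V [] _ = tt
  Below-lifts (v ∷ V) (l ∷ L) (v≺l , below) = v≺l , Below-lifts V L below

  colourOf-lifts-zero : ∀ (X : List (Elt m n)) → colourOf (lifts X) zero ≡ nothing
  colourOf-lifts-zero [] = refl
  colourOf-lifts-zero (x ∷ X) = colourOf-lifts-zero X

  colourOf-lifts-suc : ∀ (X : List (Elt m n)) x → colourOf (lifts X) (suc x) ≡ colourOf X x
  colourOf-lifts-suc [] x = refl
  colourOf-lifts-suc (e ∷ X) x rewrite colourOf-lifts-suc X x = refl

  colourOf-lifts : ∀ (Z : List (Elt m n)) (r : Code m) → (∀ x → colourOf Z x ≡ colourAt r (toℕ x)) →
    ∀ x → colourOf (lifts Z) x ≡ colourAt (nothing ∷ r) (toℕ x)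
  colourOf-lifts Z r _ zero = colourOf-lifts-zero Z
  colourOf-lifts Z r same (suc x) = trans (colourOf-lifts-suc Z x) (same x)

  colourOf-insert : ∀ (X Y : List (Elt m n)) (r : Code m) c → (∀ x → colourOf (X ++ Y) x ≡ colourAt r (toℕ x)) →
    ∀ x → colourOf (lifts X ++ (c , zero) ∷ lifts Y) x ≡ colourAt (just c ∷ r) (toℕ x)
  colourOf-insert X Y r c _ zero = at-zero X
    where
    at-zero : ∀ X → colourOf (lifts X ++ (c , zero) ∷ lifts Y) zero ≡ just c
    at-zero [] = refl
    at-zero (e ∷ X) = at-zero X
  colourOf-insert X Y r c same (suc x) = trans (skip X) (trans (cong (λ Z → colourOf Z (suc x)) (sym (List.map-++ lift X Y)))
                                           (trans (colourOf-lifts-suc (X ++ Y) x) (same x)))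
    where
    skip : ∀ X → colourOf (lifts X ++ (c , zero) ∷ lifts Y) (suc x) ≡ colourOf (lifts X ++ lifts Y) (suc x)
    skip [] = refl
    skip (e ∷ X) rewrite skip X = refl

  positions-insert : ∀ (X Y : List (Elt m n)) c → map proj₂ X ++ map proj₂ Y ↭ allFin n →
    map proj₂ (lifts X ++ (c , zero) ∷ lifts Y) ↭ allFin (suc n)
  positions-insert X Y c X++Y↭ = begin
    map proj₂ (lifts X ++ (c , zero) ∷ lifts Y)              ≡⟨ List.map-++ proj₂ (lifts X) ((c , zero) ∷ lifts Y) ⟩
    map proj₂ (lifts X) ++ zero ∷ map proj₂ (lifts Y)         ≡⟨ cong₂ (λ A B → A ++ zero ∷ B) (positions-lifts X) (positions-lifts Y) ⟩
    map suc (map proj₂ X) ++ [ zero ] ++ map suc (map proj₂ Y) ↭⟨ ↭.shift zero (map suc (map proj₂ X)) _ ⟩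
    zero ∷ map suc (map proj₂ X) ++ map suc (map proj₂ Y)     ≡⟨ cong (zero ∷_) (List.map-++ suc (map proj₂ X) (map proj₂ Y)) ⟨
    zero ∷ map suc (map proj₂ X ++ map proj₂ Y)               ↭⟨ ↭-prep zero (↭.map⁺ suc X++Y↭) ⟩
    zero ∷ map suc (allFin n)                                 ≡⟨ cong (zero ∷_) (List.map-tabulate id suc) ⟩
    allFin (suc n)                                            ∎
    where
    open PermutationReasoning
    positions-lifts : ∀ (Z : List (Elt m n)) → map proj₂ (lifts Z) ≡ map suc (map proj₂ Z)
    positions-lifts [] = refl
    positions-lifts (z ∷ Z) = cong (suc (proj₂ z) ∷_) (positions-lifts Z)

  positions-step : ∀ (V L O : List (Elt m n)) c → map proj₂ (V ++ L ++ O) ↭ allFin n →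
    map proj₂ (lifts V ++ lifts L ++ (c , zero) ∷ lifts O) ↭ allFin (suc n)
  positions-step V L O c V++L++O↭ = subst (λ W → map proj₂ W ↭ allFin (suc n)) regroup
    (positions-insert (V ++ L) O c (subst (_↭ allFin n) (trans (cong (map proj₂) (sym (List.++-assoc V L O))) (List.map-++ proj₂ (V ++ L) O)) V++L++O↭))
    where
    regroup : lifts (V ++ L) ++ (c , zero) ∷ lifts O ≡ lifts V ++ lifts L ++ (c , zero) ∷ lifts O
    regroup = trans (cong (_++ (c , zero) ∷ lifts O) (List.map-++ lift V L)) (List.++-assoc (lifts V) (lifts L) _)

-- The word v₀ p₀ v₁ p₁ … interleaves the valleys v₀ ≺ v₁ ≺ …, all of colour k, with the
-- pinnacles, those of colour k first and in increasing order.
record Plan (k n : ℕ) : Set where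
  constructor plan
  field
    valleys lowPeaks otherPeaks : List (Elt (suc k) n)

open Plan

addValley : ∀ {k n} → Plan k n → Plan k (suc n)
addValley {k} (plan V L O) = plan (lifts V ++ [ (fromℕ k , zero) ]) (lifts L) (lifts O)

addPeak : ∀ {k n} → Fin (suc k) → Bool → Plan k n → Plan k (suc n)
addPeak c true (plan V L O) = plan (lifts V) (lifts L ++ [ (c , zero) ]) (lifts O)
addPeak c false (plan V L O) = plan (lifts V) (lifts L) ((c , zero) ∷ lifts O)

-- Position zero is the largest value of its colour class, so it comes after the lifted tail.
planOf : ∀ {k} (S : Code (suc k)) → Plan k (length S)
planOf [] = plan [] [] []
planOf (nothing ∷ r) = addValley (planOf r)
planOf (just c ∷ r) = addPeak c (isLowest (just c)) (planOf r)

BelowTail : ∀ {m n} → List (Elt m n) → List (Elt m n) → Set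
BelowTail [] L = L ≡ []
BelowTail (_ ∷ V) L = Below V L

record Valid {k} (S : Code (suc k)) (P : Plan k (length S)) : Set where
  field
    valleys-lowest : All (λ v → toℕ (proj₁ v) ≡ k) (valleys P)
    lowPeaks-lowest : All (λ v → toℕ (proj₁ v) ≡ k) (lowPeaks P)
    otherPeaks-higher : All (λ v → isLowest (just (proj₁ v)) ≡ false) (otherPeaks P)
    valleys-ascending : Ascending (valleys P)
    valleys-below : BelowTail (valleys P) (lowPeaks P)
    #valleys : length (valleys P) ≡ holes S
    #lowPeaks : length (lowPeaks P) ≡ count isLowest S
    #peaks : length (lowPeaks P) + length (otherPeaks P) ≡ size S
    colourOf-peaks : ∀ x → colourOf (lowPeaks P ++ otherPeaks P) x ≡ colourAt S (toℕ x)
    positions : map proj₂ (valleys P ++ lowPeaks P ++ otherPeaks P) ↭ allFin (length S)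

open Valid

length-lifts : ∀ {m n} (X : List (Elt m n)) → length (lifts X) ≡ length X
length-lifts = List.length-map lift

lift≺zero : ∀ {m n} (v : Elt m n) c → toℕ (proj₁ v) ≡ toℕ c → (lift v ≺ (c , zero)) ≡ true
lift≺zero v c same = ≺-within-colour (lift v) (c , zero) same z<s

valid-valley : ∀ {k} (r : Code (suc k)) P → Valid r P → Valid (nothing ∷ r) (addValley P)
valid-valley {k} r (plan V L O) I = record
  { valleys-lowest = All.++⁺ (All.map⁺ (valleys-lowest I)) (toℕ-fromℕ k ∷ [])
  ; lowPeaks-lowest = All.map⁺ (lowPeaks-lowest I)
  ; otherPeaks-higher = All.map⁺ (otherPeaks-higher I)
  ; valleys-ascending = Ascending-∷ʳ (lifts V) (fromℕ k , zero) (Ascending-lifts V (valleys-ascending I))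
      (All.map⁺ (All.map (λ {v} v≡k → lift≺zero v (fromℕ k) (trans v≡k (sym (toℕ-fromℕ k)))) (valleys-lowest I)))
  ; valleys-below = below V (valleys-below I)
  ; #valleys = trans (List.length-++ (lifts V)) (trans (+-comm (length (lifts V)) 1) (cong suc (trans (length-lifts V) (#valleys I))))
  ; #lowPeaks = trans (length-lifts L) (#lowPeaks I)
  ; #peaks = trans (cong₂ _+_ (length-lifts L) (length-lifts O)) (#peaks I)
  ; colourOf-peaks = λ x → trans (cong (λ Z → colourOf Z x) (sym (List.map-++ lift L O))) (colourOf-lifts (L ++ O) r (colourOf-peaks I) x)
  ; positions = subst (λ W → map proj₂ W ↭ allFin (suc (length r))) regroup
      (positions-insert V (L ++ O) (fromℕ k) (subst (_↭ allFin (length r)) (List.map-++ proj₂ V (L ++ O)) (positions I)))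
  }
  where
  below : ∀ V → BelowTail V L → BelowTail (lifts V ++ [ (fromℕ k , zero) ]) (lifts L)
  below [] refl = tt
  below (v ∷ V) V-below = Below-++ʳ (lifts V) (lifts L) [ (fromℕ k , zero) ] (Below-lifts V L V-below)
  regroup : lifts V ++ (fromℕ k , zero) ∷ lifts (L ++ O) ≡ (lifts V ++ [ (fromℕ k , zero) ]) ++ lifts L ++ lifts O
  regroup = trans (cong (λ Z → lifts V ++ (fromℕ k , zero) ∷ Z) (List.map-++ lift L O)) (sym (List.++-assoc (lifts V) [ _ ] _))

BelowTail-lifts : ∀ {m n} (V L : List (Elt m n)) → BelowTail V L → BelowTail (lifts V) (lifts L)
BelowTail-lifts [] L refl = refl
BelowTail-lifts (v ∷ V) L below = Below-lifts V L below

valid-peak : ∀ {k} (r : Code (suc k)) c P → ballot (just c ∷ r) ≡ true → Valid r P →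
  Valid (just c ∷ r) (addPeak c (isLowest (just c)) P)
valid-peak {k} r c (plan V L O) b I with isLowest (just c) in lowest
... | true = record
  { valleys-lowest = All.map⁺ (valleys-lowest I)
  ; lowPeaks-lowest = All.++⁺ (All.map⁺ (lowPeaks-lowest I)) (≡ᵇ≡true⇒≡ lowest ∷ [])
  ; otherPeaks-higher = All.map⁺ (otherPeaks-higher I)
  ; valleys-ascending = Ascending-lifts V (valleys-ascending I)
  ; valleys-below = below V (valleys-below I) room (valleys-lowest I)
  ; #valleys = trans (length-lifts V) (#valleys I)
  ; #lowPeaks = trans (List.length-++ (lifts L)) (trans (+-comm (length (lifts L)) 1)
                  (trans (cong suc (trans (length-lifts L) (#lowPeaks I))) (cong (λ b′ → 𝟙 b′ + count isLowest r) (sym lowest))))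
  ; #peaks = trans (cong (_+ length (lifts O)) (trans (List.length-++ (lifts L)) (+-comm (length (lifts L)) 1)))
                   (cong suc (trans (cong₂ _+_ (length-lifts L) (length-lifts O)) (#peaks I)))
  ; colourOf-peaks = λ x → trans (cong (λ Z → colourOf Z x) (List.++-assoc (lifts L) [ (c , zero) ] (lifts O)))
                                 (colourOf-insert L O r c (colourOf-peaks I) x)
  ; positions = subst (λ W → map proj₂ W ↭ allFin (suc (length r)))
                      (cong (lifts V ++_) (sym (List.++-assoc (lifts L) [ (c , zero) ] (lifts O))))
                      (positions-step V L O c (positions I))
  }
  where
  room : 2 + length L ≤ length V
  room = subst₂ (λ l h → l ≤ h) (trans (cong (_+ 2) (sym (#lowPeaks I))) (+-comm (length L) 2)) (sym (#valleys I))
           (≤ᵇ≡true⇒≤ (proj₂ (∧≡true⇒ {ballot r} b)))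
  below : ∀ V → BelowTail V L → 2 + length L ≤ length V → All (λ v → toℕ (proj₁ v) ≡ k) V →
          BelowTail (lifts V) (lifts L ++ [ (c , zero) ])
  below (v ∷ V) V-below (s≤s room) (_ ∷ V-lowest) = Below-++ (lifts V) (lifts L) [ (c , zero) ] (Below-lifts V L V-below)
    (subst₂ (λ l h → l ≤ h) (trans (+-comm 1 (length L)) (cong (_+ 1) (sym (length-lifts L)))) (sym (length-lifts V)) room)
    (All.map⁺ (All.map (λ {v′} v′≡k → lift≺zero v′ c (trans v′≡k (sym (≡ᵇ≡true⇒≡ lowest))) ∷ []) V-lowest))
... | false = record
  { valleys-lowest = All.map⁺ (valleys-lowest I)
  ; lowPeaks-lowest = All.map⁺ (lowPeaks-lowest I)
  ; otherPeaks-higher = lowest ∷ All.map⁺ (otherPeaks-higher I)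
  ; valleys-ascending = Ascending-lifts V (valleys-ascending I)
  ; valleys-below = BelowTail-lifts V L (valleys-below I)
  ; #valleys = trans (length-lifts V) (#valleys I)
  ; #lowPeaks = trans (length-lifts L) (trans (#lowPeaks I) (cong (λ b′ → 𝟙 b′ + count isLowest r) (sym lowest)))
  ; #peaks = trans (cong₂ _+_ (length-lifts L) (cong suc (length-lifts O))) (trans (+-suc (length L) (length O)) (cong suc (#peaks I)))
  ; colourOf-peaks = colourOf-insert L O r c (colourOf-peaks I)
  ; positions = positions-step V L O c (positions I)
  }

valid : ∀ {k} (S : Code (suc k)) → ballot S ≡ true → Valid S (planOf S)
valid [] _ = record
  { valleys-lowest = [] ; lowPeaks-lowest = [] ; otherPeaks-higher = [] ; valleys-ascending = tt ; valleys-below = refl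
  ; #valleys = refl ; #lowPeaks = refl ; #peaks = refl ; colourOf-peaks = λ () ; positions = ↭-refl }
valid (nothing ∷ r) b = valid-valley r (planOf r) (valid r b)
valid (just c ∷ r) b = valid-peak r c (planOf r) b (valid r (proj₁ (∧≡true⇒ {ballot r} b)))

interleave-↭ : ∀ {m n} (V P : List (Elt m n)) → interleave V P ↭ V ++ P
interleave-↭ [] P = ↭-refl
interleave-↭ (v ∷ V) [] = ↭-reflexive (sym (List.++-identityʳ (v ∷ V)))
interleave-↭ (v ∷ V) (p ∷ P) = ↭-prep v (↭-trans (↭-prep p (interleave-↭ V P)) (↭-sym (↭.shift p V P)))

∈-allVecs : ∀ (xs : List A) k (w : Vec A k) → (∀ x → x ∈ xs) → w ∈ allVecs xs k
∈-allVecs xs zero [] _ = here refl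
∈-allVecs xs (suc k) (x ∷ w) every = ∈.∈-concatMap⁺ (λ y → map (y ∷_) (allVecs xs k))
  (Any.map (λ { refl → ∈.∈-map⁺ (x ∷_) (∈-allVecs xs k w every) }) (every x))

∈-SignedPerms : ∀ {m n} (w : Vec (Elt m n) n) → Unique (map proj₂ (Vec.toList w)) → w ∈ SignedPerms m n
∈-SignedPerms {m} {n} w uniq = ∈.∈-filter⁺ (λ v → Unique?.unique? (_≟ᶠ_ {n}) (map proj₂ (Vec.toList v)))
  (∈-allVecs (allElts m n) n w (λ (a , x) → ∈.∈-cartesianProductWith⁺ _,_ (∈.∈-allFin a) (∈.∈-allFin x))) uniq

pinList-interleave-valleys : ∀ {k n} (V L O : List (Elt (suc k) n)) →
  All (λ v → toℕ (proj₁ v) ≡ k) V → All (λ o → isLowest (just (proj₁ o)) ≡ false) O →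
  Ascending V → BelowTail V L → L ++ O ≡ [] ⊎ suc (length L + length O) ≤ length V →
  pinList (interleave V (L ++ O)) ≡ L ++ O
pinList-interleave-valleys [] .[] O _ _ _ refl (inj₁ O≡[]) rewrite O≡[] = refl
pinList-interleave-valleys (v ∷ V) L O _ _ asc _ (inj₁ L++O≡[]) rewrite L++O≡[] = pinList-ascending (v ∷ V) asc
pinList-interleave-valleys {k} (v ∷ V) L O (_ ∷ V-lowest) O-higher asc below (inj₂ (s≤s room)) =
  pinList-interleave v V (L ++ O) asc (Below-++ V L O below room (All.map (λ {v′} v-lowest → All.map (λ {o} → v≺o {v′} {o} v-lowest) O-higher) V-lowest))
  where
  v≺o : ∀ {v o} → toℕ (proj₁ v) ≡ k → isLowest (just (proj₁ o)) ≡ false → (v ≺ o) ≡ true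
  v≺o {v} {o} v≡k o≢k = ≺-by-colour v o (subst (toℕ (proj₁ o) <_) (sym v≡k)
    (≤∧≢⇒< (toℕ≤pred[n] (proj₁ o)) (λ o≡k → ≡false⇒≢true o≢k (≡⇒≡ᵇ≡true o≡k))))

module _ {k : ℕ} (S : Code (suc k)) (I : Valid S (planOf S)) where

  private
    V = valleys (planOf S)
    L = lowPeaks (planOf S)
    O = otherPeaks (planOf S)

  word : List (Elt (suc k) (length S))
  word = interleave V (L ++ O)

  positions-word : map proj₂ word ↭ allFin (length S)
  positions-word = ↭-trans (↭.map⁺ proj₂ (interleave-↭ V (L ++ O))) (positions I)

  enough-valleys : 2 * size S ≤ length S ∸ 1 → L ++ O ≡ [] ⊎ suc (length L + length O) ≤ length V
  enough-valleys size≤ with L ++ O in L++O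
  ... | [] = inj₁ refl
  ... | p ∷ P = inj₂ (subst (_≤ length V) (cong suc (sym #LO)) (more-valleys (length V) (length P) size≤′))
    where
    #LO : length L + length O ≡ suc (length P)
    #LO = trans (sym (List.length-++ L)) (cong length L++O)
    size≤′ : 2 * suc (length P) ≤ length V + suc (length P) ∸ 1
    size≤′ = subst (λ s → 2 * s ≤ length V + s ∸ 1) (trans (sym (#peaks I)) #LO)
               (subst (λ l → 2 * size S ≤ l ∸ 1) (trans (length≡holes+size S) (cong (_+ size S) (sym (#valleys I)))) size≤)
    more-valleys : ∀ h s → 2 * suc s ≤ h + suc s ∸ 1 → suc (suc s) ≤ h
    more-valleys h s 2s+2≤ = +-cancelʳ-≤ s (suc (suc s)) h (begin
      suc (suc s) + s    ≡⟨ solve 1 (λ s → con 2 :+ s :+ s := con 2 :* (con 1 :+ s)) refl s ⟩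
      2 * suc s          ≤⟨ 2s+2≤ ⟩
      h + suc s ∸ 1      ≡⟨ cong (_∸ 1) (+-suc h s) ⟩
      h + s              ∎)
      where open ≤-Reasoning

  pinList-word : 2 * size S ≤ length S ∸ 1 → pinList word ≡ L ++ O
  pinList-word size≤ = pinList-interleave-valleys V L O (valleys-lowest I) (otherPeaks-higher I) (valleys-ascending I) (valleys-below I) (enough-valleys size≤)

pinnacle-word : ∀ {k} n (S : Code (suc k)) → length S ≡ n → admissible S ≡ true →
  ∃ λ w → w ∈ SignedPerms (suc k) n × Pin w ≡ subsetOf n S
pinnacle-word .(length S) S refl adm = w , ∈-SignedPerms w (subst (λ W → Unique (map proj₂ W)) (sym toList-w) uniq-word) , Pin≡
  where
  I = valid S (proj₁ (∧≡true⇒ {ballot S} adm))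
  V = valleys (planOf S)
  L = lowPeaks (planOf S)
  O = otherPeaks (planOf S)
  uniq-all : Unique (map proj₂ (V ++ L ++ O))
  uniq-all = Unique-resp-↭ (↭-sym (positions I)) (Unique.allFin⁺ _)
  uniq-word : Unique (map proj₂ (word S I))
  uniq-word = Unique-resp-↭ (↭-sym (positions-word S I)) (Unique.allFin⁺ _)
  uniq-peaks : Unique (map proj₂ (L ++ O))
  uniq-peaks = Unique-++⁻ʳ (map proj₂ V) (subst Unique (List.map-++ proj₂ V (L ++ O)) uniq-all)
  len : length (word S I) ≡ length S
  len = trans (sym (List.length-map proj₂ (word S I))) (trans (↭.↭-length (positions-word S I)) (List.length-tabulate id))
  w : Vec (Elt (suc _) (length S)) (length S)
  w = Vec.cast len (Vec.fromList (word S I))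
  toList-w : Vec.toList w ≡ word S I
  toList-w = trans (Vec.toList-cast len (Vec.fromList (word S I))) (Vec.toList∘fromList (word S I))
  Pin≡ : Pin w ≡ subsetOf (length S) S
  Pin≡ = begin
    toSubsetI (pinList (Vec.toList w))              ≡⟨ cong (toSubsetI ∘ pinList) toList-w ⟩
    toSubsetI (pinList (word S I))                  ≡⟨ cong toSubsetI (pinList-word S I (≤ᵇ≡true⇒≤ (proj₂ (∧≡true⇒ {ballot S} adm)))) ⟩
    toSubsetI (L ++ O)                              ≡⟨ toSubsetI≡subsetOf (L ++ O) uniq-peaks ⟩
    subsetOf (length S) (codeOf (L ++ O))           ≡⟨ cong (subsetOf (length S)) (List.tabulate-cong (colourOf-peaks I)) ⟩
    subsetOf (length S) (tabulate {n = length S} (λ x → colourAt S (toℕ x))) ≡⟨ cong (subsetOf (length S)) (tabulate-colourAt (length S) S refl) ⟩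
    subsetOf (length S) S                           ∎
    where open ≡-Reasoning

-- Pinnacle sets are the admissible codes

module _ (k n d : ℕ) where

  admissibleCodes : List (Code (suc k))
  admissibleCodes = filterᵇ (λ s → admissible s ∧ (size s ≤ᵇ d)) (codes (suc k) n)

  APS⊆admissibleCodes : ∀ {P} → P ∈ APS d (suc k) n → P ∈ map (subsetOf n) admissibleCodes
  APS⊆admissibleCodes P∈ with ∈.∈-filter⁻ (λ P → card P ≤? d) {xs = map Pin (SignedPerms (suc k) n)} (∈.∈-deduplicate⁻ _ _ P∈)
  ... | P∈Pins , card≤d with ∈.∈-map⁻ Pin {xs = SignedPerms (suc k) n} P∈Pins
  ... | w , w∈ , refl with ∈.∈-filter⁻ (λ v → Unique?.unique? (_≟ᶠ_ {n}) (map proj₂ (Vec.toList v))) {xs = allVecs (allElts (suc k) n) n} w∈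
  ... | _ , uniq = subst (_∈ map (subsetOf n) admissibleCodes) (sym Pin≡)
        (∈.∈-map⁺ (subsetOf n) (∈.∈-filter⁺ (T? ∘ _) (∈-codes n S len) (≡true⇒T (cong₂ _∧_ adm size≤d))))
    where
    S = codeOf (pinList (Vec.toList w))
    len : length S ≡ n
    len = List.length-tabulate _
    Pin≡ : Pin w ≡ subsetOf n S
    Pin≡ = toSubsetI≡subsetOf (pinList (Vec.toList w)) (Unique-map-pinList (Vec.toList w) uniq)
    adm : admissible S ≡ true
    adm = admissible-pinList (Vec.toList w) uniq (Vec.length-toList w)
    size≤d : (size S ≤ᵇ d) ≡ true
    size≤d = ≤⇒≤ᵇ≡true (subst (_≤ d) (trans (cong card Pin≡) (card-subsetOf n S len)) card≤d)

  admissibleCodes⊆APS : ∀ {P} → P ∈ map (subsetOf n) admissibleCodes → P ∈ APS d (suc k) n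
  admissibleCodes⊆APS P∈ with ∈.∈-map⁻ (subsetOf n) {xs = admissibleCodes} P∈
  ... | S , S∈ , refl with ∈.∈-filter⁻ (T? ∘ (λ s → admissible s ∧ (size s ≤ᵇ d))) {xs = codes (suc k) n} S∈
  ... | S∈codes , good with ∧≡true⇒ {admissible S} (T⇒≡true good)
  ... | adm , size≤d with pinnacle-word n S (∈-codes⇒length n S∈codes) adm
  ... | w , w∈ , Pin≡ = ∈.∈-deduplicate⁺ _ (∈.∈-filter⁺ (λ P → card P ≤? d) (subst (_∈ map Pin (SignedPerms (suc k) n)) Pin≡ (∈.∈-map⁺ Pin w∈))
          (subst (_≤ d) (sym (card-subsetOf n S (∈-codes⇒length n S∈codes))) (≤ᵇ≡true⇒≤ size≤d)))

𝔭≡count-admissible : ∀ k n d → 𝔭 (suc k) n d ≡ count (λ s → admissible s ∧ (size s ≤ᵇ d)) (codes (suc k) n)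
𝔭≡count-admissible k n d = ≤-antisym
  (subst (length (APS d (suc k) n) ≤_) #admissible
    (Unique⇒length≤ _ _ (Dedup.deduplicate-! _) (APS⊆admissibleCodes k n d)))
  (subst (_≤ length (APS d (suc k) n)) #admissible
    (Unique⇒length≤ _ _ uniq (admissibleCodes⊆APS k n d)))
  where
  module Dedup = Data.List.Relation.Unary.Unique.DecPropositional.Properties (Vec.≡-dec (Vec.≡-dec Data.Bool.Properties._≟_))
  good = λ s → admissible s ∧ (size s ≤ᵇ d)
  #admissible : length (map (subsetOf n) (admissibleCodes k n d)) ≡ count good (codes (suc k) n)
  #admissible = trans (List.length-map (subsetOf n) (admissibleCodes k n d)) (length-filterᵇ good (codes (suc k) n))
  length≡n : ∀ {s} → s ∈ admissibleCodes k n d → length s ≡ n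
  length≡n s∈ = ∈-codes⇒length n (proj₁ (∈.∈-filter⁻ (T? ∘ good) {xs = codes (suc k) n} s∈))
  uniq : Unique (map (subsetOf n) (admissibleCodes k n d))
  uniq = Unique-map-injective-on (subsetOf n) _ (λ s∈ s′∈ → subsetOf-injective n _ _ (length≡n s∈) (length≡n s′∈))
           (Unique.filter⁺ (T? ∘ good) (Unique-codes (suc k) n))

𝔭≡ballotCount : ∀ k n d → 2 * d ≤ n ∸ 1 → 𝔭 (suc k) n d ≡ ballotCount k n d
𝔭≡ballotCount k n d 2d≤ = trans (𝔭≡count-admissible k n d) (count-admissible≡ballotCount k n d 2d≤)

2*-∸-bound : ∀ n d i → 2 * d ≤ n ∸ 1 → 2 * (d ∸ i) ≤ n ∸ i ∸ 1
2*-∸-bound n d i 2d≤ = begin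
  2 * (d ∸ i)       ≡⟨ *-distribˡ-∸ 2 d i ⟩
  2 * d ∸ 2 * i     ≤⟨ ∸-monoʳ-≤ (2 * d) (m≤m+n i (i + 0)) ⟩
  2 * d ∸ i         ≤⟨ ∸-monoˡ-≤ i 2d≤ ⟩
  n ∸ 1 ∸ i         ≡⟨ trans (∸-+-assoc n 1 i) (trans (cong (n ∸_) (+-comm 1 i)) (sym (∸-+-assoc n i 1))) ⟩
  n ∸ i ∸ 1         ∎
  where open ≤-Reasoning

d≤[n∸1]/2⇒2d≤n∸1 : ∀ n d → d ≤ (n ∸ 1) / 2 → 2 * d ≤ n ∸ 1
d≤[n∸1]/2⇒2d≤n∸1 n d d≤ = ≤-trans (*-monoʳ-≤ 2 d≤) (subst (_≤ n ∸ 1) (*-comm ((n ∸ 1) / 2) 2) (m/n*n≤m (n ∸ 1) 2))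

mainTheorem2 : ((m n d : ℕ) → 2 ≤ m → 1 ≤ n → d ≤ (n ∸ 1) / 2 →
    𝔭 m n d ≡ sum (map (λ i → (n C i) * 𝔭 (m ∸ 1) (n ∸ i) (d ∸ i)) (upTo (suc d))))
    × ((n d : ℕ) → 1 ≤ n → d ≤ (n ∸ 1) / 2 → 𝔭 1 n d ≡ (n ∸ 1) C d)
    × ((m n : ℕ) → 1 ≤ m → 1 ≤ n → 𝔭 m n 0 ≡ 1)
mainTheorem2 = recursion , one-colour , no-pinnacles
  where
  recursion : (m n d : ℕ) → 2 ≤ m → 1 ≤ n → d ≤ (n ∸ 1) / 2 →
    𝔭 m n d ≡ sum (map (λ i → (n C i) * 𝔭 (m ∸ 1) (n ∸ i) (d ∸ i)) (upTo (suc d)))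
  recursion (suc zero) _ _ (s≤s ()) _ _
  recursion (suc (suc k)) n d _ _ d≤ = begin
    𝔭 (2 + k) n d                                                        ≡⟨ 𝔭≡ballotCount (suc k) n d 2d≤ ⟩
    ballotCount (suc k) n d                                              ≡⟨ ballotCount-recursion k n d ⟩
    ∑[ i < suc d ] ((n C toℕ i) * ballotCount k (n ∸ toℕ i) (d ∸ toℕ i))
      ≡⟨ sum-cong-≗ {suc d} (λ i → cong ((n C toℕ i) *_) (sym (𝔭≡ballotCount k (n ∸ toℕ i) (d ∸ toℕ i) (2*-∸-bound n d (toℕ i) 2d≤)))) ⟩
    ∑[ i < suc d ] ((n C toℕ i) * 𝔭 (suc k) (n ∸ toℕ i) (d ∸ toℕ i))     ≡⟨ sum-map-upTo _ (suc d) ⟨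
    sum (map (λ i → (n C i) * 𝔭 (suc k) (n ∸ i) (d ∸ i)) (upTo (suc d))) ∎
    where
    open ≡-Reasoning
    2d≤ = d≤[n∸1]/2⇒2d≤n∸1 n d d≤
  one-colour : (n d : ℕ) → 1 ≤ n → d ≤ (n ∸ 1) / 2 → 𝔭 1 n d ≡ (n ∸ 1) C d
  one-colour (suc n) d _ d≤ = trans (𝔭≡ballotCount 0 (suc n) d 2d≤) (ballotCount-one-colour n d 2d≤)
    where 2d≤ = d≤[n∸1]/2⇒2d≤n∸1 (suc n) d d≤
  no-pinnacles : (m n : ℕ) → 1 ≤ m → 1 ≤ n → 𝔭 m n 0 ≡ 1
  no-pinnacles (suc k) n _ _ = trans (𝔭≡ballotCount k n 0 z≤n) (ballotCount-zero k n)
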